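{- For $n\ge1$, $$\sum_{\sigma\in\mathfrak S_n}(xy)^{{\rm L}(\sigma)}\Bigl(\frac{x+y}2\Bigr)^{n-2{\rm L}(\sigma)}\beta^{{\rm RLmin}(\sigma)}=\sum_{k=1}^n\binom nk\frac{(\beta(y-x))^{n-k}}{2^{n-k}}\sum_{\sigma\in\mathfrak S_k}x^{{\rm des}(\sigma)+1}y^{{\rm asc}(\sigma)}\beta^{{\rm LRmin}(\sigma)}+\Bigl(\frac{\beta(y-x)}2\Bigr)^n.$$
   Context: $x,y,\beta$ are indeterminates (or complex numbers). $\mathfrak S_m$ is the set of permutations $\sigma=\sigma_1\cdots\sigma_m$ of $[m]$. ${\rm L}(\sigma)$ = number of left peaks: $1\le i<m$ with $\sigma_{i-1}<\sigma_i>\sigma_{i+1}$ where $\sigma_0=0$; ${\rm des}(\sigma)$ / ${\rm asc}(\sigma)$ = number of $1\le i<m$ with $\sigma_i>\sigma_{i+1}$ / $\sigma_i<\sigma_{i+1}$; ${\rm LRmin}(\sigma)$ (resp. ${\rm RLmin}(\sigma)$) = number of entries smaller than all entries to their left (resp. right). -}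

module Defs where

open import Level using (Level)
open import Data.Nat using (ℕ; zero; suc; _<_; _<?_)
import Data.Nat as ℕ
open import Data.List using (List; []; _∷_; map; concatMap; filter; length; upTo)
open import Data.Bool using (Bool; true; false; _∧_; if_then_else_)
open import Relation.Nullary using (Dec; yes; no)
open import Relation.Nullary.Decidable using (⌊_⌋)
open import Data.List.Relation.Unary.All using (All)
import Data.List.Relation.Unary.All as All
open import Data.List.Relation.Unary.Unique.Propositional using (Unique)
open import Data.List.Relation.Unary.Unique.DecPropositional using (unique?)
import Data.Nat.Properties as ℕP
open import Algebra.Bundles using (CommutativeRing; Semiring)

-- Permutations of [m] in one-line notation σ₁ ⋯ σₘ, as lists of naturals.

words : ℕ → ℕ → List (List ℕ)
words n zero    = [] ∷ []
words n (suc k) = concatMap (λ a → map (a ∷_) (words n k)) (map suc (upTo n))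

𝔖 : ℕ → List (List ℕ)
𝔖 m = filter (unique? ℕP._≟_) (words m m)

b< : ℕ → ℕ → ℕ
b< a b = if ⌊ a <? b ⌋ then 1 else 0

des : List ℕ → ℕ
des (a ∷ b ∷ σ) = b< b a ℕ.+ des (b ∷ σ)
des _           = 0

asc : List ℕ → ℕ
asc (a ∷ b ∷ σ) = b< a b ℕ.+ asc (b ∷ σ)
asc _           = 0

peaks : List ℕ → ℕ
peaks (a ∷ b ∷ c ∷ σ) = (if ⌊ a <? b ⌋ ∧ ⌊ c <? b ⌋ then 1 else 0) ℕ.+ peaks (b ∷ c ∷ σ)
peaks _               = 0

L : List ℕ → ℕ
L σ = peaks (0 ∷ σ)

smallerThanAll : ℕ → List ℕ → Bool
smallerThanAll a []      = true
smallerThanAll a (b ∷ l) = ⌊ a <? b ⌋ ∧ smallerThanAll a l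

RLmin : List ℕ → ℕ
RLmin []      = 0
RLmin (a ∷ σ) = (if smallerThanAll a σ then 1 else 0) ℕ.+ RLmin σ

LRmin-aux : List ℕ → List ℕ → ℕ
LRmin-aux seen []      = 0
LRmin-aux seen (a ∷ σ) = (if smallerThanAll a seen then 1 else 0) ℕ.+ LRmin-aux (a ∷ seen) σ

LRmin : List ℕ → ℕ
LRmin σ = LRmin-aux [] σ

module RingSums {c ℓ : Level} (R : CommutativeRing c ℓ) where
  open CommutativeRing R
  open import Algebra.Definitions.RawSemiring (Semiring.rawSemiring semiring) public
    using (_^_; _×_)

  ΣL : {A : Set} → List A → (A → Carrier) → Carrier
  ΣL []      f = 0#
  ΣL (a ∷ l) f = f a + ΣL l f

  Σ1 : ℕ → (ℕ → Carrier) → Carrier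
  Σ1 zero    f = 0#
  Σ1 (suc n) f = Σ1 n f + f (suc n)

{-# OPTIONS --safe #-}
-- Every permutation of a set of positive labels factors uniquely as α m γ around its least entry
-- m, where α and γ arrange the two parts of a split of the other labels.  All statistics involved
-- are additive across this factorisation.  Hence the left-hand generating function 𝒫 (weight
-- (xy)^L s^(n-2L) β^RLmin, with s = (x+y)/2) satisfies 𝒫(m t) = β Σ 𝒱(α-part) 𝒫(γ-part), where
-- 𝒱 weighs the peaks of 0 α 0, while the right-hand weight x^(des+1) y^asc β^LRmin gives
-- 𝒜(m t) = β Σ 𝒜 𝒢, with 𝒢 weighing descents and ascents of 0 γ 0.  Symmetrising the recursion
-- of 𝒢 over the swap of the two parts and halving shows 𝒱 = 𝒢 on nonempty label sets, while
-- 𝒱(∅) = s = 𝒢(∅) + (y-x)/2.  Consequently 𝒯(l) = Σ_{splits} u^|γ| 𝒜(α), u = β(y-x)/2, obeys the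
-- recursion of 𝒫, so 𝒫 = 𝒯; as 𝒜 depends only on the number of labels, grouping the splits by
-- size yields the binomial sum.
module Submission where

open import Defs
open import Level using (Level)
open import Data.Nat using (ℕ; _≤_; _∸_) renaming (_*_ to _*ℕ_; _+_ to _+ℕ_)
open import Data.Nat.Combinatorics using (_C_)
open import Algebra.Bundles using (CommutativeRing)

module Arrangements where

  open import Data.Nat using (zero; suc; _+_; s≤s)
  open import Data.Nat.Properties using (m≤m+n; m≤n+m; ≤-refl; ≤-trans)
  open import Data.List using (List; []; _∷_; _++_; map; concatMap; length)
  open import Data.List.Properties using (length-++; ++-assoc; ++-cancelˡ; ∷-injectiveˡ; ∷-injectiveʳ)
  open import Data.Product using (∃; ∃₂; _×_; _,_; proj₁; proj₂; map₁; map₂)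
  open import Data.Sum using (_⊎_; inj₁; inj₂)
  open import Data.Empty using (⊥-elim)
  open import Function using (_∘_)
  open import Relation.Binary.PropositionalEquality using (_≡_; refl; sym; trans; cong; cong₂; subst)
  open import Data.List.Relation.Unary.Any using (here; there)
  open import Data.List.Relation.Unary.All as All using (All; []; _∷_)
  open import Data.List.Relation.Unary.AllPairs using (AllPairs; []; _∷_)
  open import Data.List.Membership.Propositional using (_∈_; _∉_; find; lose)
  open import Data.List.Membership.Propositional.Properties
    using (∈-map⁺; ∈-map⁻; ∈-++⁺ˡ; ∈-++⁺ʳ; ∈-++⁻; ∈-∃++; ∈-concatMap⁺; ∈-concatMap⁻)
  open import Data.List.Relation.Unary.Unique.Propositional using (Unique)
  import Data.List.Relation.Unary.Unique.Propositional.Properties as Unique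
  open import Data.List.Relation.Binary.Disjoint.Propositional using (Disjoint)
  open import Data.List.Relation.Binary.Permutation.Propositional using (_↭_; prep; ↭-refl; ↭-sym; ↭-trans)
  open import Data.List.Relation.Binary.Permutation.Propositional.Properties
    using (∈-resp-↭; shift; drop-mid; drop-∷; ↭-empty-inv; ↭-length; ++⁺)

  concatMap-cong-∈ : ∀ {X Y : Set} {f g : X → List Y} (xs : List X) →
    (∀ {x} → x ∈ xs → f x ≡ g x) → concatMap f xs ≡ concatMap g xs
  concatMap-cong-∈ []       f≡g = refl
  concatMap-cong-∈ (x ∷ xs) f≡g = cong₂ _++_ (f≡g (here refl)) (concatMap-cong-∈ xs (f≡g ∘ there))

  concatMap-unique : ∀ {X Y : Set} {f : X → List Y} {xs : List X} → Unique xs →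
    (∀ {x} → x ∈ xs → Unique (f x)) →
    (∀ {x x′ b} → x ∈ xs → x′ ∈ xs → b ∈ f x → b ∈ f x′ → x ≡ x′) →
    Unique (concatMap f xs)
  concatMap-unique [] _ _ = []
  concatMap-unique {f = f} {xs = x ∷ xs} (x∉ ∷ u) uf inj =
    Unique.++⁺ (uf (here refl)) (concatMap-unique u (uf ∘ there) (λ i j → inj (there i) (there j))) disjoint
    where
    disjoint : Disjoint (f x) (concatMap f xs)
    disjoint (b∈fx , b∈rest) with _ , x′∈ , b∈fx′ ← find (∈-concatMap⁻ f b∈rest) =
      All.lookup x∉ x′∈ (inj (here refl) (there x′∈) b∈fx b∈fx′)

  module _ {A : Set} where

    Split : Set
    Split = List A × List A

    splits : List A → List Split
    splits []      = ([] , []) ∷ []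
    splits (a ∷ t) = map (map₁ (a ∷_)) (splits t) ++ map (map₂ (a ∷_)) (splits t)

    ∈-splits⁻ : ∀ {a t p} → p ∈ splits (a ∷ t) →
      (∃ λ q → q ∈ splits t × p ≡ map₁ (a ∷_) q) ⊎ (∃ λ q → q ∈ splits t × p ≡ map₂ (a ∷_) q)
    ∈-splits⁻ {a} {t} p∈ with ∈-++⁻ (map (map₁ (a ∷_)) (splits t)) p∈
    ... | inj₁ i = inj₁ (∈-map⁻ (map₁ (a ∷_)) i)
    ... | inj₂ i = inj₂ (∈-map⁻ (map₂ (a ∷_)) i)

    splits-↭ : ∀ {t p} → p ∈ splits t → proj₁ p ++ proj₂ p ↭ t
    splits-↭ {[]} (here refl) = ↭-refl
    splits-↭ {a ∷ t} p∈ with ∈-splits⁻ {a} {t} p∈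
    ... | inj₁ (q , q∈ , refl) = prep a (splits-↭ q∈)
    ... | inj₂ (q , q∈ , refl) = ↭-trans (shift a (proj₁ q) (proj₂ q)) (prep a (splits-↭ q∈))

    splits-length : ∀ {t p} → p ∈ splits t → length (proj₁ p) + length (proj₂ p) ≡ length t
    splits-length {t} {p} p∈ = trans (sym (length-++ (proj₁ p))) (↭-length (splits-↭ {t} p∈))

    splits-length₁ : ∀ {t p} → p ∈ splits t → length (proj₁ p) ≤ length t
    splits-length₁ {t} p∈ = subst (_ ≤_) (splits-length {t} p∈) (m≤m+n _ _)

    splits-length₂ : ∀ {t p} → p ∈ splits t → length (proj₂ p) ≤ length t
    splits-length₂ {t} p∈ = subst (_ ≤_) (splits-length {t} p∈) (m≤n+m _ _)

    splits-∈₁ : ∀ {t p x} → p ∈ splits t → x ∈ proj₁ p → x ∈ t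
    splits-∈₁ {t} p∈ x∈ = ∈-resp-↭ (splits-↭ {t} p∈) (∈-++⁺ˡ x∈)

    splits-All : ∀ {P : A → Set} {t p} → p ∈ splits t → All P t → All P (proj₁ p) × All P (proj₂ p)
    splits-All {t = []} (here refl) [] = [] , []
    splits-All {t = a ∷ t} p∈ (pa ∷ pt) with ∈-splits⁻ {a} {t} p∈
    ... | inj₁ (q , q∈ , refl) = let u , v = splits-All q∈ pt in pa ∷ u , v
    ... | inj₂ (q , q∈ , refl) = let u , v = splits-All q∈ pt in u , pa ∷ v

    splits-AllPairs : ∀ {R : A → A → Set} {t p} → p ∈ splits t → AllPairs R t →
      AllPairs R (proj₁ p) × AllPairs R (proj₂ p)
    splits-AllPairs {t = []} (here refl) [] = [] , []
    splits-AllPairs {t = a ∷ t} p∈ (pa ∷ pt) with ∈-splits⁻ {a} {t} p∈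
    ... | inj₁ (q , q∈ , refl) = let u , v = splits-AllPairs q∈ pt in proj₁ (splits-All q∈ pa) ∷ u , v
    ... | inj₂ (q , q∈ , refl) = let u , v = splits-AllPairs q∈ pt in u , proj₂ (splits-All q∈ pa) ∷ v

    ↭-splits : ∀ t α γ → α ++ γ ↭ t → ∃ λ p → p ∈ splits t × α ↭ proj₁ p × γ ↭ proj₂ p
    ↭-splits [] α γ e with ↭-empty-inv e
    ↭-splits [] [] [] e | refl = ([] , []) , here refl , ↭-refl , ↭-refl
    ↭-splits (a ∷ t) α γ e with ∈-++⁻ α (∈-resp-↭ (↭-sym e) (here refl))
    ... | inj₁ a∈α with α₁ , α₂ , refl ← ∈-∃++ a∈α =
      let q , q∈ , α↭ , γ↭ = ↭-splits t (α₁ ++ α₂) γ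
            (subst (_↭ t) (sym (++-assoc α₁ α₂ γ))
              (drop-mid α₁ [] (subst (_↭ a ∷ t) (++-assoc α₁ (a ∷ α₂) γ) e)))
      in map₁ (a ∷_) q , ∈-++⁺ˡ (∈-map⁺ (map₁ (a ∷_)) q∈) , ↭-trans (shift a α₁ α₂) (prep a α↭) , γ↭
    ... | inj₂ a∈γ with γ₁ , γ₂ , refl ← ∈-∃++ a∈γ =
      let q , q∈ , α↭ , γ↭ = ↭-splits t α (γ₁ ++ γ₂)
            (subst (_↭ t) (++-assoc α γ₁ γ₂)
              (drop-mid (α ++ γ₁) [] (subst (_↭ a ∷ t) (sym (++-assoc α γ₁ (a ∷ γ₂))) e)))
      in map₂ (a ∷_) q , ∈-++⁺ʳ _ (∈-map⁺ (map₂ (a ∷_)) q∈) , α↭ , ↭-trans (shift a γ₁ γ₂) (prep a γ↭)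

    splits-unique : ∀ {t} → Unique t → Unique (splits t)
    splits-unique {[]} _ = [] ∷ []
    splits-unique {a ∷ t} (a∉ ∷ u) =
      Unique.++⁺ (Unique.map⁺ inj₁′ (splits-unique u)) (Unique.map⁺ inj₂′ (splits-unique u)) disjoint
      where
      inj₁′ : ∀ {p q : Split} → map₁ (a ∷_) p ≡ map₁ (a ∷_) q → p ≡ q
      inj₁′ {_ , _} {_ , _} refl = refl
      inj₂′ : ∀ {p q : Split} → map₂ (a ∷_) p ≡ map₂ (a ∷_) q → p ≡ q
      inj₂′ {_ , _} {_ , _} refl = refl
      disjoint : Disjoint (map (map₁ (a ∷_)) (splits t)) (map (map₂ (a ∷_)) (splits t))
      disjoint (i , j) with _ , _ , refl ← ∈-map⁻ (map₁ (a ∷_)) i | q , q∈ , e ← ∈-map⁻ (map₂ (a ∷_)) j =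
        All.lookup a∉ (splits-∈₁ q∈ (subst (a ∈_) (cong proj₁ e) (here refl))) refl

    splits-injective₁ : ∀ {t p q} → Unique t → p ∈ splits t → q ∈ splits t → proj₁ p ↭ proj₁ q → p ≡ q
    splits-injective₁ {[]} _ (here refl) (here refl) _ = refl
    splits-injective₁ {a ∷ t} (a∉ ∷ u) p∈ q∈ e with ∈-splits⁻ {a} {t} p∈ | ∈-splits⁻ {a} {t} q∈
    ... | inj₁ (p′ , p′∈ , refl) | inj₁ (q′ , q′∈ , refl) =
      cong (map₁ (a ∷_)) (splits-injective₁ u p′∈ q′∈ (drop-∷ e))
    ... | inj₁ (p′ , p′∈ , refl) | inj₂ (q′ , q′∈ , refl) =
      ⊥-elim (All.lookup a∉ (splits-∈₁ q′∈ (∈-resp-↭ e (here refl))) refl)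
    ... | inj₂ (p′ , p′∈ , refl) | inj₁ (q′ , q′∈ , refl) =
      ⊥-elim (All.lookup a∉ (splits-∈₁ p′∈ (∈-resp-↭ (↭-sym e) (here refl))) refl)
    ... | inj₂ (p′ , p′∈ , refl) | inj₂ (q′ , q′∈ , refl) =
      cong (map₂ (a ∷_)) (splits-injective₁ u p′∈ q′∈ e)

    ∉-++-∷-injective : ∀ {m : A} α α′ {γ γ′} → m ∉ α → m ∉ α′ →
      α ++ m ∷ γ ≡ α′ ++ m ∷ γ′ → α ≡ α′ × γ ≡ γ′
    ∉-++-∷-injective []      []       _ _  refl = refl , refl
    ∉-++-∷-injective []      (_ ∷ _)  _ m∉ refl = ⊥-elim (m∉ (here refl))
    ∉-++-∷-injective (_ ∷ _) []       m∉ _ refl = ⊥-elim (m∉ (here refl))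
    ∉-++-∷-injective (a ∷ α) (a′ ∷ α′) m∉ m∉′ e with refl ← ∷-injectiveˡ e
      with refl , refl ← ∉-++-∷-injective α α′ (m∉ ∘ there) (m∉′ ∘ there) (∷-injectiveʳ e) = refl , refl

    around : A → List (List A) → List (List A) → List (List A)
    around m αs γs = concatMap (λ α → map (λ γ → α ++ m ∷ γ) γs) αs

    ∈-around⁻ : ∀ {m αs γs σ} → σ ∈ around m αs γs → ∃₂ λ α γ → α ∈ αs × γ ∈ γs × σ ≡ α ++ m ∷ γ
    ∈-around⁻ {m} {αs} {γs} σ∈
      with α , α∈ , σ∈′ ← find (∈-concatMap⁻ (λ α → map (λ γ → α ++ m ∷ γ) γs) σ∈)
      with γ , γ∈ , refl ← ∈-map⁻ (λ γ → α ++ m ∷ γ) σ∈′ = α , γ , α∈ , γ∈ , refl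

    ∈-around⁺ : ∀ {m αs γs α γ} → α ∈ αs → γ ∈ γs → α ++ m ∷ γ ∈ around m αs γs
    ∈-around⁺ {m} {γs = γs} α∈ γ∈ = ∈-concatMap⁺ (λ α → map (λ γ → α ++ m ∷ γ) γs) (lose α∈ (∈-map⁺ _ γ∈))

    -- When the head m is the least entry, this lists every permutation once, as α m γ.
    -- The fuel (any bound on the length) only ensures termination.
    arrangementsᶠ : ℕ → List A → List (List A)
    arrangementsᶠ _       []      = [] ∷ []
    arrangementsᶠ zero    (_ ∷ _) = []
    arrangementsᶠ (suc f) (m ∷ t) =
      concatMap (λ p → around m (arrangementsᶠ f (proj₁ p)) (arrangementsᶠ f (proj₂ p))) (splits t)

    arrangements : List A → List (List A)
    arrangements l = arrangementsᶠ (length l) l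

    arrangementsᶠ-fuel : ∀ f g l → length l ≤ f → length l ≤ g → arrangementsᶠ f l ≡ arrangementsᶠ g l
    arrangementsᶠ-fuel f       g       []      _         _         = refl
    arrangementsᶠ-fuel (suc f) (suc g) (m ∷ t) (s≤s t≤f) (s≤s t≤g) = concatMap-cong-∈ (splits t) λ {p} p∈ →
      let p₁≤t = splits-length₁ {t} p∈ ; p₂≤t = splits-length₂ {t} p∈ in
      cong₂ (around m) (arrangementsᶠ-fuel f g (proj₁ p) (≤-trans p₁≤t t≤f) (≤-trans p₁≤t t≤g))
                       (arrangementsᶠ-fuel f g (proj₂ p) (≤-trans p₂≤t t≤f) (≤-trans p₂≤t t≤g))

    arrangements-∷ : ∀ m t →
      arrangements (m ∷ t) ≡ concatMap (λ p → around m (arrangements (proj₁ p)) (arrangements (proj₂ p))) (splits t)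
    arrangements-∷ m t = concatMap-cong-∈ (splits t) λ {p} p∈ →
      cong₂ (around m) (arrangementsᶠ-fuel _ _ (proj₁ p) (splits-length₁ {t} p∈) ≤-refl)
                       (arrangementsᶠ-fuel _ _ (proj₂ p) (splits-length₂ {t} p∈) ≤-refl)

    arrangementsᶠ-↭ : ∀ f l {σ} → σ ∈ arrangementsᶠ f l → σ ↭ l
    arrangementsᶠ-↭ f       []      (here refl) = ↭-refl
    arrangementsᶠ-↭ (suc f) (m ∷ t) σ∈
      with p , p∈ , σ∈′ ← find (∈-concatMap⁻ (λ p → around m (arrangementsᶠ f (proj₁ p)) (arrangementsᶠ f (proj₂ p))) σ∈)
      with α , γ , α∈ , γ∈ , refl ← ∈-around⁻ {m} {arrangementsᶠ f (proj₁ p)} σ∈′ =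
      ↭-trans (shift m α γ) (prep m (↭-trans
        (++⁺ (arrangementsᶠ-↭ f (proj₁ p) α∈) (arrangementsᶠ-↭ f (proj₂ p) γ∈)) (splits-↭ {t} p∈)))

    arrangements-↭ : ∀ {l σ} → σ ∈ arrangements l → σ ↭ l
    arrangements-↭ {l} = arrangementsᶠ-↭ (length l) l

    ↭⇒∈-arrangementsᶠ : ∀ f l {σ} → length l ≤ f → σ ↭ l → σ ∈ arrangementsᶠ f l
    ↭⇒∈-arrangementsᶠ f [] _ e with refl ← ↭-empty-inv e = here refl
    ↭⇒∈-arrangementsᶠ (suc f) (m ∷ t) (s≤s l≤f) e
      with α , γ , refl ← ∈-∃++ (∈-resp-↭ (↭-sym e) (here refl))
      with p , p∈ , α↭ , γ↭ ← ↭-splits t α γ (drop-mid α [] e) =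
      ∈-concatMap⁺ _ (lose p∈ (∈-around⁺
        (↭⇒∈-arrangementsᶠ f (proj₁ p) (≤-trans (splits-length₁ {t} p∈) l≤f) α↭)
        (↭⇒∈-arrangementsᶠ f (proj₂ p) (≤-trans (splits-length₂ {t} p∈) l≤f) γ↭)))

    ↭⇒∈-arrangements : ∀ {l σ} → σ ↭ l → σ ∈ arrangements l
    ↭⇒∈-arrangements {l} = ↭⇒∈-arrangementsᶠ (length l) l ≤-refl

    around-unique : ∀ {m αs γs} → Unique αs → Unique γs → (∀ {α} → α ∈ αs → m ∉ α) → Unique (around m αs γs)
    around-unique {m} {αs} {γs} uα uγ m∉ =
      concatMap-unique uα (λ {α} _ → Unique.map⁺ (∷-injectiveʳ ∘ ++-cancelˡ α _ _) uγ) injective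
      where
      injective : ∀ {α α′ σ} → α ∈ αs → α′ ∈ αs →
        σ ∈ map (λ γ → α ++ m ∷ γ) γs → σ ∈ map (λ γ → α′ ++ m ∷ γ) γs → α ≡ α′
      injective {α} {α′} i i′ j j′
        with _ , _ , refl ← ∈-map⁻ (λ γ → α ++ m ∷ γ) j | _ , _ , e ← ∈-map⁻ (λ γ → α′ ++ m ∷ γ) j′ =
        proj₁ (∉-++-∷-injective α α′ (m∉ i) (m∉ i′) e)

    arrangementsᶠ-unique : ∀ f l → Unique l → Unique (arrangementsᶠ f l)
    arrangementsᶠ-unique f       []      _          = [] ∷ []
    arrangementsᶠ-unique zero    (m ∷ t) _          = []
    arrangementsᶠ-unique (suc f) (m ∷ t) (m∉ ∷ u) = concatMap-unique (splits-unique u)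
      (λ {p} p∈ → let u₁ , u₂ = splits-AllPairs {t = t} p∈ u in
        around-unique (arrangementsᶠ-unique f (proj₁ p) u₁) (arrangementsᶠ-unique f (proj₂ p) u₂) (m∉α p∈))
      injective
      where
      m∉α : ∀ {p α} → p ∈ splits t → α ∈ arrangementsᶠ f (proj₁ p) → m ∉ α
      m∉α {p} p∈ α∈ m∈ = All.lookup m∉ (splits-∈₁ {t} p∈ (∈-resp-↭ (arrangementsᶠ-↭ f (proj₁ p) α∈) m∈)) refl
      injective : ∀ {p q σ} → p ∈ splits t → q ∈ splits t →
        σ ∈ around m (arrangementsᶠ f (proj₁ p)) (arrangementsᶠ f (proj₂ p)) →
        σ ∈ around m (arrangementsᶠ f (proj₁ q)) (arrangementsᶠ f (proj₂ q)) → p ≡ q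
      injective {p} {q} p∈ q∈ i j
        with α , _ , α∈ , _ , refl ← ∈-around⁻ {m} {arrangementsᶠ f (proj₁ p)} i
           | α′ , _ , α′∈ , _ , e ← ∈-around⁻ {m} {arrangementsᶠ f (proj₁ q)} j
        with refl , _ ← ∉-++-∷-injective α α′ (m∉α p∈ α∈) (m∉α q∈ α′∈) e =
        splits-injective₁ u p∈ q∈
          (↭-trans (↭-sym (arrangementsᶠ-↭ f (proj₁ p) α∈)) (arrangementsᶠ-↭ f (proj₁ q) α′∈))

    arrangements-unique : ∀ {l} → Unique l → Unique (arrangements l)
    arrangements-unique {l} = arrangementsᶠ-unique (length l) l

module Permutations where

  open import Data.Nat using (zero; suc; _<_; _≟_; z≤n; s≤s)
  open import Data.Nat.Properties using (suc-injective; ≤-reflexive; <⇒≱; ≤-trans)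
  open import Data.List using (List; []; _∷_; _++_; map; length; upTo)
  open import Data.List.Properties using (length-map; length-upTo; length-++-sucʳ; map-applyUpTo; ∷-injectiveʳ)
  open import Data.Product using (_×_; _,_; proj₁; proj₂)
  open import Data.Sum using (inj₁; inj₂)
  open import Data.Empty using (⊥-elim)
  open import Function using (_∘_; id)
  open import Function.Bundles using (mk⇔)
  open import Relation.Nullary using (yes; no)
  open import Relation.Binary.PropositionalEquality using (_≡_; refl; sym; trans; cong; subst)
  open import Data.List.Relation.Unary.Any using (here; there)
  open import Data.List.Relation.Unary.All as All using (All; []; _∷_)
  open import Data.List.Relation.Unary.All.Properties using (All¬⇒¬Any)
  open import Data.List.Relation.Unary.AllPairs as AllPairs using (AllPairs; []; _∷_)
  import Data.List.Relation.Unary.AllPairs.Properties as AllPairs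
  import Data.List.Relation.Unary.All.Properties as All
  open import Data.List.Membership.Propositional using (_∈_; _∉_; find; lose)
  open import Data.List.Membership.Propositional.Properties
    using (∈-map⁺; ∈-map⁻; ∈-++⁺ˡ; ∈-++⁺ʳ; ∈-++⁻; ∈-∃++; ∈-concatMap⁺; ∈-concatMap⁻; ∈-filter⁺; ∈-filter⁻)
  open import Data.List.Membership.DecPropositional _≟_ using (_∈?_)
  open import Data.List.Relation.Unary.Unique.Propositional using (Unique)
  import Data.List.Relation.Unary.Unique.Propositional.Properties as Unique
  open import Data.List.Relation.Unary.Unique.DecPropositional using (unique?)
  open import Data.List.Relation.Binary.Permutation.Propositional using (_↭_; ↭-sym; ↭⇒↭ₛ)
  open import Data.List.Relation.Binary.Permutation.Propositional.Properties using (All-resp-↭; ↭-length)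
  open import Data.List.Relation.Binary.Permutation.Setoid.Properties (Relation.Binary.PropositionalEquality.setoid ℕ)
    using (Unique-resp-↭)
  open import Data.List.Relation.Binary.BagAndSetEquality using (∼bag⇒↭)
  open import Data.List.Membership.Propositional.Properties.WithK using (unique∧set⇒bag)
  open Arrangements

  range : ℕ → List ℕ
  range n = map suc (upTo n)

  length-range : ∀ n → length (range n) ≡ n
  length-range n = trans (length-map suc (upTo n)) (length-upTo n)

  range-unique : ∀ n → Unique (range n)
  range-unique n = Unique.map⁺ suc-injective (Unique.upTo⁺ n)

  ∈-words⁻ : ∀ n k {σ} → σ ∈ words n k → length σ ≡ k × All (_∈ range n) σ
  ∈-words⁻ n zero    (here refl) = refl , []
  ∈-words⁻ n (suc k) σ∈
    with a , a∈ , σ∈′ ← find (∈-concatMap⁻ (λ a → map (a ∷_) (words n k)) {xs = range n} σ∈)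
    with τ , τ∈ , refl ← ∈-map⁻ (a ∷_) σ∈′ =
    let len , τ⊆ = ∈-words⁻ n k τ∈ in cong suc len , a∈ ∷ τ⊆

  ∈-words⁺ : ∀ n k {σ} → length σ ≡ k → All (_∈ range n) σ → σ ∈ words n k
  ∈-words⁺ n zero    {[]}    refl []         = here refl
  ∈-words⁺ n (suc k) {a ∷ σ} refl (a∈ ∷ σ⊆) =
    ∈-concatMap⁺ (λ a → map (a ∷_) (words n k)) (lose a∈ (∈-map⁺ (a ∷_) (∈-words⁺ n k refl σ⊆)))

  words-unique : ∀ n k → Unique (words n k)
  words-unique n zero    = [] ∷ []
  words-unique n (suc k) = concatMap-unique {f = λ a → map (a ∷_) (words n k)}
    (range-unique n) (λ _ → Unique.map⁺ ∷-injectiveʳ (words-unique n k)) injective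
    where
    injective : ∀ {a b σ} → a ∈ range n → b ∈ range n →
      σ ∈ map (a ∷_) (words n k) → σ ∈ map (b ∷_) (words n k) → a ≡ b
    injective {a} {b} _ _ i j with _ , _ , refl ← ∈-map⁻ (a ∷_) i | _ , _ , refl ← ∈-map⁻ (b ∷_) j = refl

  𝔖-unique : ∀ n → Unique (𝔖 n)
  𝔖-unique n = Unique.filter⁺ (unique? _≟_) (words-unique n n)

  module _ {A : Set} where

    All-∈-remove : ∀ {x : A} τ₁ τ₂ {σ} → x ∉ σ → All (_∈ τ₁ ++ x ∷ τ₂) σ → All (_∈ τ₁ ++ τ₂) σ
    All-∈-remove τ₁ τ₂ x∉ []         = []
    All-∈-remove τ₁ τ₂ x∉ (y∈ ∷ σ⊆) with ∈-++⁻ τ₁ y∈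
    ... | inj₁ y∈τ₁          = ∈-++⁺ˡ y∈τ₁ ∷ All-∈-remove τ₁ τ₂ (x∉ ∘ there) σ⊆
    ... | inj₂ (here refl)    = ⊥-elim (x∉ (here refl))
    ... | inj₂ (there y∈τ₂)   = ∈-++⁺ʳ τ₁ y∈τ₂ ∷ All-∈-remove τ₁ τ₂ (x∉ ∘ there) σ⊆

    Unique-⊆⇒length≤ : ∀ {σ τ : List A} → Unique σ → All (_∈ τ) σ → length σ ≤ length τ
    Unique-⊆⇒length≤ []         []         = z≤n
    Unique-⊆⇒length≤ (a∉ ∷ uσ) (a∈ ∷ σ⊆) with τ₁ , τ₂ , refl ← ∈-∃++ a∈ =
      ≤-trans (s≤s (Unique-⊆⇒length≤ uσ (All-∈-remove τ₁ τ₂ (All¬⇒¬Any a∉) σ⊆)))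
              (≤-reflexive (sym (length-++-sucʳ τ₁ _ τ₂)))

  Unique-⊆-length⇒⊇ : ∀ {σ τ : List ℕ} → Unique σ → All (_∈ τ) σ → length τ ≤ length σ →
    ∀ {x} → x ∈ τ → x ∈ σ
  Unique-⊆-length⇒⊇ {σ} uσ σ⊆ τ≤σ {x} x∈ with x ∈? σ
  ... | yes x∈σ = x∈σ
  ... | no x∉σ with τ₁ , τ₂ , refl ← ∈-∃++ x∈ =
    ⊥-elim (<⇒≱ (≤-trans (≤-reflexive (sym (length-++-sucʳ τ₁ _ τ₂))) τ≤σ)
                (Unique-⊆⇒length≤ uσ (All-∈-remove τ₁ τ₂ x∉σ σ⊆)))

  ∈-𝔖⇒↭ : ∀ {n σ} → σ ∈ 𝔖 n → σ ↭ range n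
  ∈-𝔖⇒↭ {n} σ∈ with σ∈w , uσ ← ∈-filter⁻ (unique? _≟_) σ∈ with len , σ⊆ ← ∈-words⁻ n n σ∈w =
    ∼bag⇒↭ (unique∧set⇒bag uσ (range-unique n)
      (mk⇔ (All.lookup σ⊆) (Unique-⊆-length⇒⊇ uσ σ⊆ (≤-reflexive (trans (length-range n) (sym len))))))

  ↭⇒∈-𝔖 : ∀ {n σ} → σ ↭ range n → σ ∈ 𝔖 n
  ↭⇒∈-𝔖 {n} e = ∈-filter⁺ (unique? _≟_)
    (∈-words⁺ n n (trans (↭-length e) (length-range n)) (All-resp-↭ (↭-sym e) (All.tabulate id)))
    (Unique-resp-↭ (↭⇒↭ₛ (↭-sym e)) (range-unique n))

  𝔖↭arrangements : ∀ n → 𝔖 n ↭ arrangements (range n)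
  𝔖↭arrangements n = ∼bag⇒↭ (unique∧set⇒bag (𝔖-unique n) (arrangements-unique (range-unique n))
    (mk⇔ (↭⇒∈-arrangements ∘ ∈-𝔖⇒↭ {n}) (↭⇒∈-𝔖 {n} ∘ arrangements-↭ {l = range n})))

  IncreasingPositive : List ℕ → Set
  IncreasingPositive l = All (0 <_) l × AllPairs _<_ l

  range-increasingPositive : ∀ n → IncreasingPositive (range n)
  range-increasingPositive n =
    All.map⁺ (All.universal (λ _ → s≤s z≤n) (upTo n)) ,
    subst (AllPairs _<_) (sym (map-applyUpTo id suc n)) (AllPairs.applyUpTo⁺₁ suc n (λ i<j _ → s≤s i<j))

  module _ {m t} (inc : IncreasingPositive (m ∷ t)) where

    increasingPositive-head : 0 < m
    increasingPositive-head = All.head (proj₁ inc)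

    increasingPositive-minimum : All (m <_) t
    increasingPositive-minimum = AllPairs.head (proj₂ inc)

    increasingPositive-tail : IncreasingPositive t
    increasingPositive-tail = All.tail (proj₁ inc) , AllPairs.tail (proj₂ inc)

  module _ {t p} (inc : IncreasingPositive t) (p∈ : p ∈ splits t) where

    increasingPositive-splits₁ : IncreasingPositive (proj₁ p)
    increasingPositive-splits₁ =
      proj₁ (splits-All {t = t} p∈ (proj₁ inc)) , proj₁ (splits-AllPairs {t = t} p∈ (proj₂ inc))

    increasingPositive-splits₂ : IncreasingPositive (proj₂ p)
    increasingPositive-splits₂ =
      proj₂ (splits-All {t = t} p∈ (proj₁ inc)) , proj₂ (splits-AllPairs {t = t} p∈ (proj₂ inc))

module Statistics where

  open import Data.Nat
  open import Data.Nat.Properties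
  open import Data.List using (List; []; _∷_; _++_; [_]; length)
  open import Data.List.Properties using (length-++; ++-assoc)
  open import Data.Bool using (true; false; _∧_; if_then_else_)
  open import Data.Bool.Properties using (∧-zeroʳ)
  open import Data.Empty using (⊥-elim)
  open import Relation.Nullary using (¬_; Dec; yes; no)
  open import Relation.Nullary.Decidable using (⌊_⌋)
  open import Relation.Binary.PropositionalEquality using (_≡_; refl; sym; trans; cong; cong₂; subst)
  open import Data.List.Relation.Unary.Any using (here; there)
  open import Data.List.Relation.Unary.All as All using (All; []; _∷_)
  open import Data.List.Membership.Propositional using (_∈_)

  ⌊<?⌋-true : ∀ {a b} → a < b → ⌊ a <? b ⌋ ≡ true
  ⌊<?⌋-true {a} {b} a<b with a <? b
  ... | yes _   = refl
  ... | no  a≮b = ⊥-elim (a≮b a<b)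

  ⌊<?⌋-false : ∀ {a b} → b < a → ⌊ a <? b ⌋ ≡ false
  ⌊<?⌋-false {a} {b} b<a with a <? b
  ... | yes a<b = ⊥-elim (<-asym a<b b<a)
  ... | no  _   = refl

  nonempty : List ℕ → ℕ
  nonempty []      = 0
  nonempty (_ ∷ _) = 1

  des-++-∷ : ∀ α m γ → des (α ++ m ∷ γ) ≡ des (α ++ [ m ]) + des (m ∷ γ)
  des-++-∷ []          m γ = refl
  des-++-∷ (a ∷ [])    m γ = cong (_+ des (m ∷ γ)) (sym (+-identityʳ _))
  des-++-∷ (a ∷ b ∷ α) m γ = trans (cong (b< b a +_) (des-++-∷ (b ∷ α) m γ)) (sym (+-assoc (b< b a) _ _))

  asc-++-∷ : ∀ α m γ → asc (α ++ m ∷ γ) ≡ asc (α ++ [ m ]) + asc (m ∷ γ)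
  asc-++-∷ []          m γ = refl
  asc-++-∷ (a ∷ [])    m γ = cong (_+ asc (m ∷ γ)) (sym (+-identityʳ _))
  asc-++-∷ (a ∷ b ∷ α) m γ = trans (cong (b< a b +_) (asc-++-∷ (b ∷ α) m γ)) (sym (+-assoc (b< a b) _ _))

  des-∷ʳ-below : ∀ α m → All (m <_) α → des (α ++ [ m ]) ≡ des α + nonempty α
  des-∷ʳ-below []          m _               = refl
  des-∷ʳ-below (a ∷ [])    m (m<a ∷ [])      rewrite ⌊<?⌋-true m<a = refl
  des-∷ʳ-below (a ∷ b ∷ α) m (_ ∷ m<bα) =
    trans (cong (b< b a +_) (des-∷ʳ-below (b ∷ α) m m<bα)) (sym (+-assoc (b< b a) _ _))

  asc-∷ʳ-below : ∀ α m → All (m <_) α → asc (α ++ [ m ]) ≡ asc α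
  asc-∷ʳ-below []          m _               = refl
  asc-∷ʳ-below (a ∷ [])    m (m<a ∷ [])      rewrite ⌊<?⌋-false m<a = refl
  asc-∷ʳ-below (a ∷ b ∷ α) m (_ ∷ m<bα) = cong (b< a b +_) (asc-∷ʳ-below (b ∷ α) m m<bα)

  des-∷-below : ∀ m γ → All (m <_) γ → des (m ∷ γ) ≡ des γ
  des-∷-below m []      _         = refl
  des-∷-below m (c ∷ γ) (m<c ∷ _) rewrite ⌊<?⌋-false m<c = refl

  asc-∷-below : ∀ m γ → All (m <_) γ → asc (m ∷ γ) ≡ asc γ + nonempty γ
  asc-∷-below m []      _         = refl
  asc-∷-below m (c ∷ γ) (m<c ∷ _) rewrite ⌊<?⌋-true m<c = +-comm 1 _

  des-at-minimum : ∀ α m γ → All (m <_) α → All (m <_) γ → des (α ++ m ∷ γ) ≡ des α + nonempty α + des γ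
  des-at-minimum α m γ m<α m<γ =
    trans (des-++-∷ α m γ) (cong₂ _+_ (des-∷ʳ-below α m m<α) (des-∷-below m γ m<γ))

  asc-at-minimum : ∀ α m γ → All (m <_) α → All (m <_) γ → asc (α ++ m ∷ γ) ≡ asc α + (asc γ + nonempty γ)
  asc-at-minimum α m γ m<α m<γ =
    trans (asc-++-∷ α m γ) (cong₂ _+_ (asc-∷ʳ-below α m m<α) (asc-∷-below m γ m<γ))

  smallerThanAll-true : ∀ {m} l → All (m <_) l → smallerThanAll m l ≡ true
  smallerThanAll-true []      _             = refl
  smallerThanAll-true (b ∷ l) (m<b ∷ m<l) rewrite ⌊<?⌋-true m<b = smallerThanAll-true l m<l

  smallerThanAll-false : ∀ {m c} l → m ∈ l → m < c → smallerThanAll c l ≡ false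
  smallerThanAll-false (b ∷ l) (here refl) m<c rewrite ⌊<?⌋-false m<c = refl
  smallerThanAll-false (b ∷ l) (there m∈) m<c rewrite smallerThanAll-false l m∈ m<c = ∧-zeroʳ _

  ∈-++-∷ : ∀ (α : List ℕ) m γ → m ∈ α ++ m ∷ γ
  ∈-++-∷ []      m γ = here refl
  ∈-++-∷ (a ∷ α) m γ = there (∈-++-∷ α m γ)

  RLmin-at-minimum : ∀ α m γ → All (m <_) α → All (m <_) γ → RLmin (α ++ m ∷ γ) ≡ suc (RLmin γ)
  RLmin-at-minimum []      m γ _             m<γ rewrite smallerThanAll-true γ m<γ = refl
  RLmin-at-minimum (a ∷ α) m γ (m<a ∷ m<α) m<γ
    rewrite smallerThanAll-false (α ++ m ∷ γ) (∈-++-∷ α m γ) m<a = RLmin-at-minimum α m γ m<α m<γ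

  LRmin-aux-after : ∀ {m} seen γ → m ∈ seen → All (m <_) γ → LRmin-aux seen γ ≡ 0
  LRmin-aux-after seen []      _  _             = refl
  LRmin-aux-after seen (c ∷ γ) m∈ (m<c ∷ m<γ)
    rewrite smallerThanAll-false seen m∈ m<c = LRmin-aux-after (c ∷ seen) γ (there m∈) m<γ

  LRmin-aux-at-minimum : ∀ seen α m γ → All (m <_) seen → All (m <_) α → All (m <_) γ →
    LRmin-aux seen (α ++ m ∷ γ) ≡ LRmin-aux seen α + 1
  LRmin-aux-at-minimum seen [] m γ m<seen _ m<γ
    rewrite smallerThanAll-true seen m<seen | LRmin-aux-after (m ∷ seen) γ (here refl) m<γ = refl
  LRmin-aux-at-minimum seen (a ∷ α) m γ m<seen (m<a ∷ m<α) m<γ =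
    trans (cong (new +_) (LRmin-aux-at-minimum (a ∷ seen) α m γ (m<a ∷ m<seen) m<α m<γ)) (sym (+-assoc new _ 1))
    where
    new : ℕ
    new = if smallerThanAll a seen then 1 else 0

  LRmin-at-minimum : ∀ α m γ → All (m <_) α → All (m <_) γ → LRmin (α ++ m ∷ γ) ≡ LRmin α + 1
  LRmin-at-minimum α m γ = LRmin-aux-at-minimum [] α m γ []

  peak : ℕ → ℕ → ℕ → ℕ
  peak a b c = if ⌊ a <? b ⌋ ∧ ⌊ c <? b ⌋ then 1 else 0

  peak-ascent : ∀ a {b c} → b < c → peak a b c ≡ 0
  peak-ascent a {b} b<c rewrite ⌊<?⌋-false b<c | ∧-zeroʳ ⌊ a <? b ⌋ = refl

  peak-descent : ∀ {a b} c → b < a → peak a b c ≡ 0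
  peak-descent c b<a rewrite ⌊<?⌋-false b<a = refl

  peaks-head : ∀ {a a′ b} v → a < b → a′ < b → peaks (a ∷ b ∷ v) ≡ peaks (a′ ∷ b ∷ v)
  peaks-head []      _   _    = refl
  peaks-head (c ∷ v) a<b a′<b rewrite ⌊<?⌋-true a<b | ⌊<?⌋-true a′<b = refl

  peaks-last : ∀ {m m′} z α → All (m <_) α → All (m′ <_) α → peaks (z ∷ α ++ [ m ]) ≡ peaks (z ∷ α ++ [ m′ ])
  peaks-last z []          _             _               = refl
  peaks-last z (b ∷ [])    (m<b ∷ [])   (m′<b ∷ [])    rewrite ⌊<?⌋-true m<b | ⌊<?⌋-true m′<b = refl
  peaks-last z (b ∷ c ∷ α) (_ ∷ m<cα) (_ ∷ m′<cα) = cong (peak z b c +_) (peaks-last b (c ∷ α) m<cα m′<cα)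

  peaks-descent : ∀ {b m} v → m < b → peaks (b ∷ m ∷ v) ≡ peaks (m ∷ v)
  peaks-descent []      _   = refl
  peaks-descent (c ∷ v) m<b = cong (_+ peaks (_ ∷ c ∷ v)) (peak-descent c m<b)

  peaks-split-ascent : ∀ {m c} z α v → m < c →
    peaks (z ∷ α ++ m ∷ c ∷ v) ≡ peaks (z ∷ α ++ [ m ]) + peaks (m ∷ c ∷ v)
  peaks-split-ascent z []          v m<c rewrite peak-ascent z m<c = refl
  peaks-split-ascent z (a ∷ [])    v m<c rewrite peak-ascent a m<c = cong (_+ peaks (_ ∷ _ ∷ v)) (sym (+-identityʳ _))
  peaks-split-ascent z (a ∷ b ∷ α) v m<c =
    trans (cong (peak z a b +_) (peaks-split-ascent a (b ∷ α) v m<c)) (sym (+-assoc (peak z a b) _ _))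

  peaks-split-descent : ∀ {m} z b α v → All (m <_) (b ∷ α) →
    peaks (z ∷ (b ∷ α) ++ m ∷ v) ≡ peaks (z ∷ (b ∷ α) ++ [ m ]) + peaks (m ∷ v)
  peaks-split-descent z b []      v (m<b ∷ []) =
    trans (cong (peak z b _ +_) (peaks-descent v m<b)) (cong (_+ peaks (_ ∷ v)) (sym (+-identityʳ _)))
  peaks-split-descent z b (c ∷ α) v (_ ∷ m<cα) =
    trans (cong (peak z b c +_) (peaks-split-descent b c α v m<cα)) (sym (+-assoc (peak z b c) _ _))

  peaks₀ : List ℕ → ℕ
  peaks₀ α = peaks (0 ∷ α ++ [ 0 ])

  peaks-∷ʳ-positive : ∀ {m} α → 0 < m → All (m <_) α → peaks (0 ∷ α ++ [ m ]) ≡ peaks₀ α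
  peaks-∷ʳ-positive α 0<m m<α = peaks-last 0 α m<α (All.map (<-trans 0<m) m<α)

  peaks-split-at-minimum : ∀ {m c} α v → 0 < m → All (m <_) α → m < c →
    peaks (0 ∷ α ++ m ∷ c ∷ v) ≡ peaks₀ α + peaks (0 ∷ c ∷ v)
  peaks-split-at-minimum α v 0<m m<α m<c =
    trans (peaks-split-ascent 0 α v m<c)
          (cong₂ _+_ (peaks-∷ʳ-positive α 0<m m<α) (peaks-head v m<c (<-trans 0<m m<c)))

  L-at-minimum : ∀ α m γ → 0 < m → All (m <_) α → All (m <_) γ → L (α ++ m ∷ γ) ≡ peaks₀ α + L γ
  L-at-minimum α m []      0<m m<α _         = trans (peaks-∷ʳ-positive α 0<m m<α) (sym (+-identityʳ _))
  L-at-minimum α m (c ∷ γ) 0<m m<α (m<c ∷ _) = peaks-split-at-minimum α γ 0<m m<α m<c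

  peaks₀-at-minimum : ∀ α m γ → 0 < m → All (m <_) α → All (m <_) γ → 1 ≤ length α + length γ →
    peaks₀ (α ++ m ∷ γ) ≡ peaks₀ α + peaks₀ γ
  peaks₀-at-minimum α m (c ∷ γ) 0<m m<α (m<c ∷ _) _ rewrite ++-assoc α (m ∷ c ∷ γ) [ 0 ] =
    peaks-split-at-minimum α (γ ++ [ 0 ]) 0<m m<α m<c
  peaks₀-at-minimum (b ∷ α) m [] 0<m m<bα _ _ rewrite ++-assoc (b ∷ α) [ m ] [ 0 ] =
    trans (peaks-split-descent 0 b α [ 0 ] m<bα) (cong (_+ 0) (peaks-∷ʳ-positive (b ∷ α) 0<m m<bα))

  peaks₀-singleton : ∀ {m} → 0 < m → peaks₀ [ m ] ≡ 1
  peaks₀-singleton 0<m rewrite ⌊<?⌋-true 0<m = refl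

  peak-≤1 : ∀ a b c → peak a b c ≤ 1
  peak-≤1 a b c with ⌊ a <? b ⌋ ∧ ⌊ c <? b ⌋
  ... | true  = ≤-refl
  ... | false = z≤n

  peak-non-descent : ∀ a {b c} → ¬ c < b → peak a b c ≡ 0
  peak-non-descent a {b} {c} c≮b with c <? b
  ... | yes c<b = ⊥-elim (c≮b c<b)
  ... | no  _   rewrite ∧-zeroʳ ⌊ a <? b ⌋ = refl

  peaks-bound : ∀ a l → 2 * peaks (a ∷ l) ≤ length l
  peaks-bound a []          = z≤n
  peaks-bound a (b ∷ [])    = z≤n
  peaks-bound a (b ∷ c ∷ σ) = step (c <? b) (peaks-bound b (c ∷ σ)) (peaks-bound c σ)
    where
    open ≤-Reasoning
    step : Dec (c < b) → 2 * peaks (b ∷ c ∷ σ) ≤ 1 + length σ → 2 * peaks (c ∷ σ) ≤ length σ →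
      2 * (peak a b c + peaks (b ∷ c ∷ σ)) ≤ 2 + length σ
    step (no c≮b) bound-b _ = begin
      2 * (peak a b c + peaks (b ∷ c ∷ σ)) ≡⟨ cong (λ k → 2 * (k + peaks (b ∷ c ∷ σ))) (peak-non-descent a c≮b) ⟩
      2 * peaks (b ∷ c ∷ σ)                ≤⟨ bound-b ⟩
      1 + length σ                         ≤⟨ n≤1+n _ ⟩
      2 + length σ                         ∎
    step (yes c<b) _ bound-c = begin
      2 * (peak a b c + peaks (b ∷ c ∷ σ)) ≤⟨ *-monoʳ-≤ 2 (+-mono-≤ (peak-≤1 a b c) (≤-reflexive (peaks-descent σ c<b))) ⟩
      2 * (1 + peaks (c ∷ σ))              ≡⟨ *-distribˡ-+ 2 1 (peaks (c ∷ σ)) ⟩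
      2 + 2 * peaks (c ∷ σ)                ≤⟨ +-monoʳ-≤ 2 bound-c ⟩
      2 + length σ                         ∎

  L-bound : ∀ σ → 2 * L σ ≤ length σ
  L-bound = peaks-bound 0

  peaks₀-bound : ∀ α → 2 * peaks₀ α ≤ length α + 1
  peaks₀-bound α = subst (2 * peaks₀ α ≤_) (length-++ α) (peaks-bound 0 (α ++ [ 0 ]))

  [m+n]∸[o+p]≡[m∸o]+[n∸p] : ∀ m n o p → o ≤ m → p ≤ n → (m + n) ∸ (o + p) ≡ (m ∸ o) + (n ∸ p)
  [m+n]∸[o+p]≡[m∸o]+[n∸p] m n o p o≤m p≤n =
    trans (sym (∸-+-assoc (m + n) o p)) (trans (cong (_∸ p) (+-∸-comm n o≤m)) (+-∸-assoc (m ∸ o) p≤n))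

module Sums {c ℓ : Level} (R : CommutativeRing c ℓ) where

  open import Data.Nat using (zero; suc; z≤n; s≤s)
  import Data.Nat.Properties as ℕ
  open import Data.Nat.Combinatorics using (nCk+nC[k+1]≡[n+1]C[k+1]; k>n⇒nCk≡0)
  open import Data.List using (List; []; _∷_; _++_; map; concatMap; length)
  open import Data.Product using (_,_; proj₁; proj₂; map₁; map₂; uncurry)
  open import Data.Sum using (inj₁; inj₂)
  open import Function using (_∘_)
  open import Relation.Binary.PropositionalEquality as ≡ using (_≡_)
  open import Data.List.Relation.Unary.Any using (here; there)
  open import Data.List.Membership.Propositional using (_∈_)
  open import Data.List.Membership.Propositional.Properties using (∈-map⁺; ∈-++⁺ˡ; ∈-++⁺ʳ)
  open import Data.List.Relation.Binary.Permutation.Propositional as ↭ using (_↭_)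
  open Arrangements

  open CommutativeRing R
  open RingSums R
  open import Algebra.Properties.CommutativeSemigroup +-commutativeSemigroup using (interchange; x∙yz≈y∙xz)
  import Algebra.Properties.Semiring.Mult semiring as Mult
  open import Relation.Binary.Reasoning.Setoid setoid

  module _ {A : Set} where

    ΣL-++ : ∀ (xs ys : List A) f → ΣL (xs ++ ys) f ≈ ΣL xs f + ΣL ys f
    ΣL-++ []       ys f = sym (+-identityˡ _)
    ΣL-++ (a ∷ xs) ys f = trans (+-congˡ (ΣL-++ xs ys f)) (sym (+-assoc _ _ _))

    ΣL-cong : ∀ (xs : List A) {f g} → (∀ {a} → a ∈ xs → f a ≈ g a) → ΣL xs f ≈ ΣL xs g
    ΣL-cong []       f≈g = refl
    ΣL-cong (a ∷ xs) f≈g = +-cong (f≈g (here ≡.refl)) (ΣL-cong xs (f≈g ∘ there))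

    ΣL-+ : ∀ (xs : List A) f g → ΣL xs (λ a → f a + g a) ≈ ΣL xs f + ΣL xs g
    ΣL-+ []       f g = sym (+-identityˡ _)
    ΣL-+ (a ∷ xs) f g = trans (+-congˡ (ΣL-+ xs f g)) (interchange _ _ _ _)

    ΣL-*ˡ : ∀ (xs : List A) k f → ΣL xs (λ a → k * f a) ≈ k * ΣL xs f
    ΣL-*ˡ []       k f = sym (zeroʳ k)
    ΣL-*ˡ (a ∷ xs) k f = trans (+-congˡ (ΣL-*ˡ xs k f)) (sym (distribˡ k _ _))

    ΣL-*ʳ : ∀ (xs : List A) k f → ΣL xs (λ a → f a * k) ≈ ΣL xs f * k
    ΣL-*ʳ []       k f = sym (zeroˡ k)
    ΣL-*ʳ (a ∷ xs) k f = trans (+-congˡ (ΣL-*ʳ xs k f)) (sym (distribʳ k _ _))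

    ΣL-↭ : ∀ {xs ys : List A} f → xs ↭ ys → ΣL xs f ≈ ΣL ys f
    ΣL-↭ f ↭.refl          = refl
    ΣL-↭ f (↭.prep x p)    = +-congˡ (ΣL-↭ f p)
    ΣL-↭ f (↭.swap x y p)  =
      trans (sym (+-assoc _ _ _)) (trans (+-congʳ (+-comm _ _)) (trans (+-assoc _ _ _) (+-congˡ (+-congˡ (ΣL-↭ f p)))))
    ΣL-↭ f (↭.trans p q)   = trans (ΣL-↭ f p) (ΣL-↭ f q)

  module _ {A B : Set} where

    ΣL-map : ∀ (g : A → B) (xs : List A) f → ΣL (map g xs) f ≈ ΣL xs (f ∘ g)
    ΣL-map g []       f = refl
    ΣL-map g (a ∷ xs) f = +-congˡ (ΣL-map g xs f)

    ΣL-concatMap : ∀ (g : A → List B) (xs : List A) f → ΣL (concatMap g xs) f ≈ ΣL xs (λ a → ΣL (g a) f)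
    ΣL-concatMap g []       f = refl
    ΣL-concatMap g (a ∷ xs) f = trans (ΣL-++ (g a) (concatMap g xs) f) (+-congˡ (ΣL-concatMap g xs f))

  module _ {A : Set} where

    ΣL-splits-∷ : ∀ a t F →
      ΣL (splits {A} (a ∷ t)) F ≈ ΣL (splits t) (F ∘ map₁ (a ∷_)) + ΣL (splits t) (F ∘ map₂ (a ∷_))
    ΣL-splits-∷ a t F =
      trans (ΣL-++ (map (map₁ (a ∷_)) (splits t)) _ F) (+-cong (ΣL-map _ (splits t) F) (ΣL-map _ (splits t) F))

    ΣL-splits-swap : ∀ t F → ΣL (splits {A} t) F ≈ ΣL (splits t) (λ p → F (proj₂ p , proj₁ p))
    ΣL-splits-swap []      F = refl
    ΣL-splits-swap (a ∷ t) F = begin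
      ΣL (splits (a ∷ t)) F
        ≈⟨ ΣL-splits-∷ a t F ⟩
      ΣL (splits t) (F ∘ map₁ (a ∷_)) + ΣL (splits t) (F ∘ map₂ (a ∷_))
        ≈⟨ +-cong (ΣL-splits-swap t _) (ΣL-splits-swap t _) ⟩
      ΣL (splits t) (λ p → F (a ∷ proj₂ p , proj₁ p)) + ΣL (splits t) (λ p → F (proj₂ p , a ∷ proj₁ p))
        ≈⟨ +-comm _ _ ⟩
      ΣL (splits t) (λ p → F (proj₂ p , a ∷ proj₁ p)) + ΣL (splits t) (λ p → F (a ∷ proj₂ p , proj₁ p))
        ≈⟨ ΣL-splits-∷ a t _ ⟨
      ΣL (splits (a ∷ t)) (λ p → F (proj₂ p , proj₁ p)) ∎

    -- Both sides run over the splits of t into three parts (X , Y , Z), as ((X , Y) , Z) and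
    -- as (Y , (X , Z)) respectively.
    ΣL-splits-assoc : ∀ t (f : List A → List A → List A → Carrier) →
      ΣL (splits t) (λ p → ΣL (splits (proj₁ p)) (λ q → f (proj₁ q) (proj₂ q) (proj₂ p))) ≈
      ΣL (splits t) (λ p → ΣL (splits (proj₂ p)) (λ q → f (proj₁ q) (proj₁ p) (proj₂ q)))
    ΣL-splits-assoc []      f = refl
    ΣL-splits-assoc (a ∷ t) f = begin
      left (a ∷ t) f
        ≈⟨ ΣL-splits-∷ a t _ ⟩
      ΣL (splits t) (λ p → ΣL (splits (a ∷ proj₁ p)) (λ q → f (proj₁ q) (proj₂ q) (proj₂ p))) + left t f₃
        ≈⟨ +-congʳ (ΣL-cong (splits t) (λ {p} _ → ΣL-splits-∷ a (proj₁ p) _)) ⟩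
      ΣL (splits t) (λ p → ΣL (splits (proj₁ p)) (λ q → f₁ (proj₁ q) (proj₂ q) (proj₂ p))
                         + ΣL (splits (proj₁ p)) (λ q → f₂ (proj₁ q) (proj₂ q) (proj₂ p))) + left t f₃
        ≈⟨ +-congʳ (ΣL-+ (splits t) _ _) ⟩
      left t f₁ + left t f₂ + left t f₃
        ≈⟨ +-cong (+-cong (ΣL-splits-assoc t f₁) (ΣL-splits-assoc t f₂)) (ΣL-splits-assoc t f₃) ⟩
      right t f₁ + right t f₂ + right t f₃
        ≈⟨ trans (+-congʳ (+-comm _ _)) (+-assoc _ _ _) ⟩
      right t f₂ + (right t f₁ + right t f₃)
        ≈⟨ +-congˡ (ΣL-+ (splits t) _ _) ⟨
      right t f₂ + ΣL (splits t) (λ p → ΣL (splits (proj₂ p)) (λ q → f₁ (proj₁ q) (proj₁ p) (proj₂ q))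
                                     + ΣL (splits (proj₂ p)) (λ q → f₃ (proj₁ q) (proj₁ p) (proj₂ q)))
        ≈⟨ +-congˡ (ΣL-cong (splits t) (λ {p} _ → ΣL-splits-∷ a (proj₂ p) _)) ⟨
      right t f₂ + ΣL (splits t) (λ p → ΣL (splits (a ∷ proj₂ p)) (λ q → f (proj₁ q) (proj₁ p) (proj₂ q)))
        ≈⟨ ΣL-splits-∷ a t _ ⟨
      right (a ∷ t) f ∎
      where
      left right : List A → (List A → List A → List A → Carrier) → Carrier
      left  t f = ΣL (splits t) (λ p → ΣL (splits (proj₁ p)) (λ q → f (proj₁ q) (proj₂ q) (proj₂ p)))
      right t f = ΣL (splits t) (λ p → ΣL (splits (proj₂ p)) (λ q → f (proj₁ q) (proj₁ p) (proj₂ q)))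
      f₁ f₂ f₃ : List A → List A → List A → Carrier
      f₁ α β γ = f (a ∷ α) β γ
      f₂ α β γ = f α (a ∷ β) γ
      f₃ α β γ = f α β (a ∷ γ)

    ΣL-splits-symmetrise : ∀ t (F G : List A → List A → Carrier) →
      (∀ {p} → p ∈ splits t →
        F (proj₁ p) (proj₂ p) + F (proj₂ p) (proj₁ p) ≈ G (proj₁ p) (proj₂ p) + G (proj₁ p) (proj₂ p)) →
      ΣL (splits t) (uncurry F) + ΣL (splits t) (uncurry F) ≈ ΣL (splits t) (uncurry G) + ΣL (splits t) (uncurry G)
    ΣL-splits-symmetrise t F G F-sym≈G = begin
      ΣL (splits t) (uncurry F) + ΣL (splits t) (uncurry F)
        ≈⟨ +-congˡ (ΣL-splits-swap t (uncurry F)) ⟩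
      ΣL (splits t) (uncurry F) + ΣL (splits t) (λ p → F (proj₂ p) (proj₁ p))
        ≈⟨ ΣL-+ (splits t) _ _ ⟨
      ΣL (splits t) (λ p → F (proj₁ p) (proj₂ p) + F (proj₂ p) (proj₁ p))
        ≈⟨ ΣL-cong (splits t) F-sym≈G ⟩
      ΣL (splits t) (λ p → G (proj₁ p) (proj₂ p) + G (proj₁ p) (proj₂ p))
        ≈⟨ ΣL-+ (splits t) _ _ ⟩
      ΣL (splits t) (uncurry G) + ΣL (splits t) (uncurry G) ∎

    ΣL-splits-parallel : ∀ t t′ (F F′ : Split → Carrier) → length t ≡ length t′ →
      (∀ {p p′} → p ∈ splits t → p′ ∈ splits t′ →
        length (proj₁ p) ≡ length (proj₁ p′) → length (proj₂ p) ≡ length (proj₂ p′) → F p ≈ F′ p′) →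
      ΣL (splits t) F ≈ ΣL (splits t′) F′
    ΣL-splits-parallel []      []        F F′ _  F≈F′ = +-congʳ (F≈F′ (here ≡.refl) (here ≡.refl) ≡.refl ≡.refl)
    ΣL-splits-parallel (a ∷ t) (a′ ∷ t′) F F′ t≡t′ F≈F′ = begin
      ΣL (splits (a ∷ t)) F
        ≈⟨ ΣL-splits-∷ a t F ⟩
      ΣL (splits t) (F ∘ map₁ (a ∷_)) + ΣL (splits t) (F ∘ map₂ (a ∷_))
        ≈⟨ +-cong (ΣL-splits-parallel t t′ _ _ (ℕ.suc-injective t≡t′) λ p∈ p′∈ e₁ e₂ →
                     F≈F′ (∈-++⁺ˡ (∈-map⁺ (map₁ (a ∷_)) p∈)) (∈-++⁺ˡ (∈-map⁺ (map₁ (a′ ∷_)) p′∈))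
                          (≡.cong suc e₁) e₂)
                  (ΣL-splits-parallel t t′ _ _ (ℕ.suc-injective t≡t′) λ p∈ p′∈ e₁ e₂ →
                     F≈F′ (∈-++⁺ʳ _ (∈-map⁺ (map₂ (a ∷_)) p∈)) (∈-++⁺ʳ _ (∈-map⁺ (map₂ (a′ ∷_)) p′∈))
                          e₁ (≡.cong suc e₂)) ⟩
      ΣL (splits t′) (F′ ∘ map₁ (a′ ∷_)) + ΣL (splits t′) (F′ ∘ map₂ (a′ ∷_))
        ≈⟨ ΣL-splits-∷ a′ t′ F′ ⟨
      ΣL (splits (a′ ∷ t′)) F′ ∎

    𝟙[] : List A → Carrier
    𝟙[] []      = 1#
    𝟙[] (_ ∷ _) = 0#

    ΣL-splits-𝟙[] : ∀ t g → ΣL (splits t) (λ p → 𝟙[] (proj₁ p) * g (proj₂ p)) ≈ g t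
    ΣL-splits-𝟙[] []      g = trans (+-identityʳ _) (*-identityˡ _)
    ΣL-splits-𝟙[] (a ∷ t) g = begin
      ΣL (splits (a ∷ t)) (λ p → 𝟙[] (proj₁ p) * g (proj₂ p))
        ≈⟨ ΣL-splits-∷ a t _ ⟩
      ΣL (splits t) (λ p → 0# * g (proj₂ p)) + ΣL (splits t) (λ p → 𝟙[] (proj₁ p) * g (a ∷ proj₂ p))
        ≈⟨ +-cong (trans (ΣL-*ˡ (splits t) 0# _) (zeroˡ _)) (ΣL-splits-𝟙[] t (λ γ → g (a ∷ γ))) ⟩
      0# + g (a ∷ t)
        ≈⟨ +-identityˡ _ ⟩
      g (a ∷ t) ∎

  Σ₀ : ℕ → (ℕ → Carrier) → Carrier
  Σ₀ N f = f 0 + Σ1 N f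

  Σ1-suc : ∀ N f → Σ1 (suc N) f ≈ f 1 + Σ1 N (f ∘ suc)
  Σ1-suc zero    f = trans (+-identityˡ _) (sym (+-identityʳ _))
  Σ1-suc (suc N) f = trans (+-congʳ (Σ1-suc N f)) (+-assoc _ _ _)

  Σ₀-suc : ∀ N f → Σ₀ (suc N) f ≈ f 0 + Σ₀ N (f ∘ suc)
  Σ₀-suc N f = +-congˡ (Σ1-suc N f)

  Σ1-+ : ∀ N f g → Σ1 N (λ k → f k + g k) ≈ Σ1 N f + Σ1 N g
  Σ1-+ zero    f g = sym (+-identityˡ _)
  Σ1-+ (suc N) f g = trans (+-congʳ (Σ1-+ N f g)) (interchange _ _ _ _)

  Σ₀-+ : ∀ N f g → Σ₀ N (λ k → f k + g k) ≈ Σ₀ N f + Σ₀ N g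
  Σ₀-+ N f g = trans (+-congˡ (Σ1-+ N f g)) (interchange _ _ _ _)

  Σ1-cong : ∀ N {f g} → (∀ k → 1 ≤ k → k ≤ N → f k ≈ g k) → Σ1 N f ≈ Σ1 N g
  Σ1-cong zero    f≈g = refl
  Σ1-cong (suc N) f≈g =
    +-cong (Σ1-cong N (λ k 1≤k k≤N → f≈g k 1≤k (ℕ.m≤n⇒m≤1+n k≤N))) (f≈g (suc N) (s≤s z≤n) ℕ.≤-refl)

  Σ₀-cong : ∀ N {f g} → (∀ k → k ≤ N → f k ≈ g k) → Σ₀ N f ≈ Σ₀ N g
  Σ₀-cong N f≈g = +-cong (f≈g 0 z≤n) (Σ1-cong N (λ k _ → f≈g k))

  binomialSum : ℕ → (ℕ → ℕ → Carrier) → Carrier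
  binomialSum N g = Σ₀ N (λ k → (N C k) × g k (N ∸ k))

  ×-C-vanishes : ∀ N x → (N C suc N) × x ≈ 0#
  ×-C-vanishes N x = trans (Mult.×-congˡ (k>n⇒nCk≡0 (ℕ.n<1+n N))) (Mult.×-homo-0 x)

  -- Pascal's rule; in the second sum the coefficient of the term k = N is N C (N + 1) = 0.
  binomialSum-suc : ∀ N g →
    binomialSum (suc N) g ≈ binomialSum N (λ i j → g (suc i) j) + binomialSum N (λ i j → g i (suc j))
  binomialSum-suc N g = begin
    binomialSum (suc N) g
      ≈⟨ Σ₀-suc N _ ⟩
    φ 0 + Σ₀ N (λ k → (suc N C suc k) × g (suc k) (N ∸ k))
      ≈⟨ +-congˡ (Σ₀-cong N λ k _ →
           trans (Mult.×-congˡ (≡.sym (nCk+nC[k+1]≡[n+1]C[k+1] N k))) (Mult.×-homo-+ _ (N C k) _)) ⟩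
    φ 0 + Σ₀ N (λ k → (N C k) × g (suc k) (N ∸ k) + (N C suc k) × g (suc k) (N ∸ k))
      ≈⟨ +-congˡ (Σ₀-+ N _ _) ⟩
    φ 0 + (binomialSum N (λ i j → g (suc i) j) + Σ₀ N (λ k → (N C suc k) × g (suc k) (N ∸ k)))
      ≈⟨ x∙yz≈y∙xz _ _ _ ⟩
    binomialSum N (λ i j → g (suc i) j) + (φ 0 + Σ₀ N (λ k → (N C suc k) × g (suc k) (N ∸ k)))
      ≈⟨ +-congˡ (+-congˡ (Σ₀-cong N shift)) ⟩
    binomialSum N (λ i j → g (suc i) j) + (φ 0 + Σ₀ N (φ ∘ suc))
      ≈⟨ +-congˡ (Σ₀-suc N φ) ⟨
    binomialSum N (λ i j → g (suc i) j) + Σ₀ (suc N) φ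
      ≈⟨ +-congˡ (+-assoc _ _ _) ⟨
    binomialSum N (λ i j → g (suc i) j) + (Σ₀ N φ + φ (suc N))
      ≈⟨ +-congˡ (trans (+-congˡ (×-C-vanishes N _)) (+-identityʳ _)) ⟩
    binomialSum N (λ i j → g (suc i) j) + binomialSum N (λ i j → g i (suc j)) ∎
    where
    φ : ℕ → Carrier
    φ k = (N C k) × g k (suc (N ∸ k))
    shift : ∀ k → k ≤ N → (N C suc k) × g (suc k) (N ∸ k) ≈ φ (suc k)
    shift k k≤N with ℕ.m≤n⇒m<n∨m≡n k≤N
    ... | inj₁ k<N    = Mult.×-congʳ (N C suc k) (reflexive (≡.cong (g (suc k)) (ℕ.+-∸-assoc 1 k<N)))
    ... | inj₂ ≡.refl = trans (×-C-vanishes k _) (sym (×-C-vanishes k _))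

  ΣL-splits-lengths : ∀ {A : Set} (t : List A) g →
    ΣL (splits t) (λ p → g (length (proj₁ p)) (length (proj₂ p))) ≈ binomialSum (length t) g
  ΣL-splits-lengths []      g = trans (+-identityʳ _) (sym (trans (+-identityʳ _) (Mult.×-homo-1 _)))
  ΣL-splits-lengths (a ∷ t) g = begin
    ΣL (splits (a ∷ t)) (λ p → g (length (proj₁ p)) (length (proj₂ p)))
      ≈⟨ ΣL-splits-∷ a t _ ⟩
    ΣL (splits t) (λ p → g (suc (length (proj₁ p))) (length (proj₂ p))) +
    ΣL (splits t) (λ p → g (length (proj₁ p)) (suc (length (proj₂ p))))
      ≈⟨ +-cong (ΣL-splits-lengths t (λ i j → g (suc i) j)) (ΣL-splits-lengths t (λ i j → g i (suc j))) ⟩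
    binomialSum (length t) (λ i j → g (suc i) j) + binomialSum (length t) (λ i j → g i (suc j))
      ≈⟨ binomialSum-suc (length t) g ⟨
    binomialSum (length (a ∷ t)) g ∎


module GeneratingFunctions {c ℓ : Level} (R : CommutativeRing c ℓ) where

  open import Data.Nat using (suc; _<_; z≤n; s≤s)
  import Data.Nat.Properties as ℕ
  open import Data.Nat.Solver using (module +-*-Solver)
  open import Data.List using (List; []; _∷_; _++_; map; concatMap; length)
  open import Data.List.Properties using (length-++)
  open import Data.Product using (_,_; proj₁; proj₂)
  open import Relation.Binary.PropositionalEquality as ≡ using (_≡_)
  open import Data.List.Relation.Unary.All using (All; _∷_)
  open import Data.List.Relation.Unary.AllPairs using (_∷_)
  open import Data.List.Membership.Propositional using (_∈_)
  open import Data.List.Relation.Binary.Permutation.Propositional using (↭-sym)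
  open import Data.List.Relation.Binary.Permutation.Propositional.Properties using (All-resp-↭; ↭-length)
  open Arrangements
  open Permutations
  open Statistics

  open CommutativeRing R
  open RingSums R
  open Sums R
  open import Algebra.Properties.Semiring.Exp semiring using (^-homo-*; ^-congʳ)
  open import Algebra.Properties.Ring ring using (+-cancelʳ)
  import Algebra.Properties.Semiring.Mult semiring as Mult
  open import Algebra.Properties.CommutativeSemigroup *-commutativeSemigroup using (interchange; x∙yz≈y∙xz; x∙yz≈z∙xy)
  open import Algebra.Properties.CommutativeSemigroup +-commutativeSemigroup using () renaming (interchange to +-interchange)
  open import Relation.Binary.Reasoning.Setoid setoid

  monomial : Carrier → Carrier → Carrier → ℕ → ℕ → ℕ → Carrier
  monomial a b e i j k = a ^ i * b ^ j * e ^ k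

  monomial-+ : ∀ a b e i j k i′ j′ k′ →
    monomial a b e (i +ℕ i′) (j +ℕ j′) (k +ℕ k′) ≈ monomial a b e i j k * monomial a b e i′ j′ k′
  monomial-+ a b e i j k i′ j′ k′ = begin
    a ^ (i +ℕ i′) * b ^ (j +ℕ j′) * e ^ (k +ℕ k′)
      ≈⟨ *-cong (*-cong (^-homo-* a i i′) (^-homo-* b j j′)) (^-homo-* e k k′) ⟩
    (a ^ i * a ^ i′) * (b ^ j * b ^ j′) * (e ^ k * e ^ k′)
      ≈⟨ *-congʳ (interchange _ _ _ _) ⟩
    (a ^ i * b ^ j) * (a ^ i′ * b ^ j′) * (e ^ k * e ^ k′)
      ≈⟨ interchange _ _ _ _ ⟩
    monomial a b e i j k * monomial a b e i′ j′ k′ ∎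

  monomial-cong : ∀ a b e {i i′ j j′ k k′} → i ≡ i′ → j ≡ j′ → k ≡ k′ →
    monomial a b e i j k ≈ monomial a b e i′ j′ k′
  monomial-cong a b e ≡.refl ≡.refl ≡.refl = refl

  monomial-e¹ : ∀ a b e i j → monomial a b e i j 1 ≈ e * monomial a b e i j 0
  monomial-e¹ a b e i j = trans (*-congˡ (*-identityʳ e)) (trans (*-comm _ _) (*-congˡ (sym (*-identityʳ _))))

  record SplitAtMinimum (m : ℕ) (α γ : List ℕ) : Set where
    field
      positive : 0 < m
      below-α  : All (m <_) α
      below-γ  : All (m <_) γ

  ΣL-arrangements-∷ : ∀ {A : Set} (m : A) t (f : List A → Carrier) → ΣL (arrangements (m ∷ t)) f ≈
    ΣL (splits t) (λ p → ΣL (arrangements (proj₁ p)) (λ α → ΣL (arrangements (proj₂ p)) (λ γ → f (α ++ m ∷ γ))))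
  ΣL-arrangements-∷ m t f = begin
    ΣL (arrangements (m ∷ t)) f
      ≡⟨ ≡.cong (λ l → ΣL l f) (arrangements-∷ m t) ⟩
    ΣL (concatMap (λ p → around m (arrangements (proj₁ p)) (arrangements (proj₂ p))) (splits t)) f
      ≈⟨ ΣL-concatMap _ (splits t) f ⟩
    ΣL (splits t) (λ p → ΣL (around m (arrangements (proj₁ p)) (arrangements (proj₂ p))) f)
      ≈⟨ ΣL-cong (splits t) (λ {p} _ → ΣL-around (arrangements (proj₁ p)) (arrangements (proj₂ p))) ⟩
    ΣL (splits t) (λ p → ΣL (arrangements (proj₁ p)) (λ α → ΣL (arrangements (proj₂ p)) (λ γ → f (α ++ m ∷ γ)))) ∎
    where
    ΣL-around : ∀ αs γs → ΣL (around m αs γs) f ≈ ΣL αs (λ α → ΣL γs (λ γ → f (α ++ m ∷ γ)))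
    ΣL-around αs γs = trans (ΣL-concatMap (λ α → map (λ γ → α ++ m ∷ γ) γs) αs f)
                            (ΣL-cong αs (λ {α} _ → ΣL-map (λ γ → α ++ m ∷ γ) γs f))

  ΣL-arrangements-at-minimum : ∀ m t (F f g : List ℕ → Carrier) k → IncreasingPositive (m ∷ t) →
    (∀ α γ → SplitAtMinimum m α γ → length α +ℕ length γ ≡ length t → F (α ++ m ∷ γ) ≈ k * (f α * g γ)) →
    ΣL (arrangements (m ∷ t)) F ≈ k * ΣL (splits t) (λ p → ΣL (arrangements (proj₁ p)) f * ΣL (arrangements (proj₂ p)) g)
  ΣL-arrangements-at-minimum m t F f g k inc factorise = begin
    ΣL (arrangements (m ∷ t)) F
      ≈⟨ ΣL-arrangements-∷ m t F ⟩
    ΣL (splits t) (λ p → ΣL (arrangements (proj₁ p)) (λ α → ΣL (arrangements (proj₂ p)) (λ γ → F (α ++ m ∷ γ))))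
      ≈⟨ ΣL-cong (splits t) (λ {p} p∈ → ΣL-part p p∈) ⟩
    ΣL (splits t) (λ p → k * (ΣL (arrangements (proj₁ p)) f * ΣL (arrangements (proj₂ p)) g))
      ≈⟨ ΣL-*ˡ (splits t) k _ ⟩
    k * ΣL (splits t) (λ p → ΣL (arrangements (proj₁ p)) f * ΣL (arrangements (proj₂ p)) g) ∎
    where
    ΣL-part : ∀ p → p ∈ splits t →
      ΣL (arrangements (proj₁ p)) (λ α → ΣL (arrangements (proj₂ p)) (λ γ → F (α ++ m ∷ γ))) ≈
      k * (ΣL (arrangements (proj₁ p)) f * ΣL (arrangements (proj₂ p)) g)
    ΣL-part (A , C) p∈ = begin
      ΣL (arrangements A) (λ α → ΣL (arrangements C) (λ γ → F (α ++ m ∷ γ)))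
        ≈⟨ ΣL-cong (arrangements A) (λ α∈ → ΣL-cong (arrangements C) (λ γ∈ →
             trans (factorise _ _ (split α∈ γ∈) (lengths α∈ γ∈)) (sym (*-assoc _ _ _)))) ⟩
      ΣL (arrangements A) (λ α → ΣL (arrangements C) (λ γ → k * f α * g γ))
        ≈⟨ ΣL-cong (arrangements A) (λ {α} _ → ΣL-*ˡ (arrangements C) (k * f α) g) ⟩
      ΣL (arrangements A) (λ α → k * f α * ΣL (arrangements C) g)
        ≈⟨ ΣL-*ʳ (arrangements A) _ _ ⟩
      ΣL (arrangements A) (λ α → k * f α) * ΣL (arrangements C) g
        ≈⟨ *-congʳ (ΣL-*ˡ (arrangements A) k f) ⟩
      k * ΣL (arrangements A) f * ΣL (arrangements C) g
        ≈⟨ *-assoc _ _ _ ⟩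
      k * (ΣL (arrangements A) f * ΣL (arrangements C) g) ∎
      where
      m<A : All (m <_) A
      m<A = proj₁ (splits-All {t = t} p∈ (increasingPositive-minimum inc))
      m<C : All (m <_) C
      m<C = proj₂ (splits-All {t = t} p∈ (increasingPositive-minimum inc))
      split : ∀ {α γ} → α ∈ arrangements A → γ ∈ arrangements C → SplitAtMinimum m α γ
      split α∈ γ∈ = record
        { positive = increasingPositive-head inc
        ; below-α  = All-resp-↭ (↭-sym (arrangements-↭ {l = A} α∈)) m<A
        ; below-γ  = All-resp-↭ (↭-sym (arrangements-↭ {l = C} γ∈)) m<C }
      lengths : ∀ {α γ} → α ∈ arrangements A → γ ∈ arrangements C → length α +ℕ length γ ≡ length t
      lengths α∈ γ∈ =
        ≡.trans (≡.cong₂ _+ℕ_ (↭-length (arrangements-↭ {l = A} α∈)) (↭-length (arrangements-↭ {l = C} γ∈)))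
                (splits-length {t = t} p∈)

  module Weights (h : Carrier) (h+h≈1 : h + h ≈ 1#) (x y β : Carrier) where

    s d u : Carrier
    s = (x + y) * h
    d = (y - x) * h
    u = β * (y - x) * h

    peakWeight peak₀Weight eulerWeight frameWeightˣ frameWeightʸ : List ℕ → Carrier
    peakWeight σ  = (x * y) ^ L σ * s ^ (length σ ∸ 2 *ℕ L σ) * β ^ RLmin σ
    peak₀Weight σ = (x * y) ^ peaks₀ σ * s ^ ((length σ +ℕ 1) ∸ 2 *ℕ peaks₀ σ)
    eulerWeight []          = 1#
    eulerWeight σ@(_ ∷ _)   = x ^ (des σ +ℕ 1) * y ^ asc σ * β ^ LRmin σ
    -- x ^ des * y ^ asc of the framed word 0 σ 0; the empty word, whose frame 0 0 is flat,
    -- is given the weight x, resp. y.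
    frameWeightˣ []         = x
    frameWeightˣ σ@(_ ∷ _)  = x ^ (des σ +ℕ 1) * y ^ (asc σ +ℕ 1)
    frameWeightʸ []         = y
    frameWeightʸ σ@(_ ∷ _)  = x ^ (des σ +ℕ 1) * y ^ (asc σ +ℕ 1)

    eulerWeight-monomial : ∀ σ → eulerWeight σ ≈ monomial x y β (des σ +ℕ nonempty σ) (asc σ) (LRmin σ)
    eulerWeight-monomial []      = sym (trans (*-identityʳ _) (*-identityʳ _))
    eulerWeight-monomial (_ ∷ _) = refl

    frameWeightˣ-monomial : ∀ σ → frameWeightˣ σ ≈ monomial x y β (des σ +ℕ 1) (asc σ +ℕ nonempty σ) 0
    frameWeightˣ-monomial []      = sym (trans (*-identityʳ _) (trans (*-identityʳ _) (*-identityʳ _)))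
    frameWeightˣ-monomial (_ ∷ _) = sym (*-identityʳ _)

    frameWeightʸ-monomial : ∀ σ → frameWeightʸ σ ≈ monomial x y β (des σ +ℕ nonempty σ) (asc σ +ℕ 1) 0
    frameWeightʸ-monomial []      = sym (trans (*-identityʳ _) (trans (*-identityˡ _) (*-identityʳ _)))
    frameWeightʸ-monomial (_ ∷ _) = sym (*-identityʳ _)

    nonempty-++-∷ : ∀ α (m : ℕ) γ → nonempty (α ++ m ∷ γ) ≡ 1
    nonempty-++-∷ []      m γ = ≡.refl
    nonempty-++-∷ (_ ∷ _) m γ = ≡.refl

    module _ {m α γ} (split : SplitAtMinimum m α γ) where

      open SplitAtMinimum split
      open +-*-Solver using (solve; _:+_; _:=_; con)

      private
        σ : List ℕ
        σ = α ++ m ∷ γ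

      eulerWeight-at-minimum : eulerWeight σ ≈ β * (eulerWeight α * frameWeightˣ γ)
      eulerWeight-at-minimum = begin
        eulerWeight σ
          ≈⟨ eulerWeight-monomial σ ⟩
        monomial x y β (des σ +ℕ nonempty σ) (asc σ) (LRmin σ)
          ≈⟨ monomial-cong x y β des≡ (asc-at-minimum α m γ below-α below-γ) (LRmin-at-minimum α m γ below-α below-γ) ⟩
        monomial x y β ((des α +ℕ nonempty α) +ℕ (des γ +ℕ 1)) (asc α +ℕ (asc γ +ℕ nonempty γ)) (LRmin α +ℕ 1)
          ≈⟨ monomial-+ x y β (des α +ℕ nonempty α) (asc α) (LRmin α) (des γ +ℕ 1) (asc γ +ℕ nonempty γ) 1 ⟩
        monomial x y β (des α +ℕ nonempty α) (asc α) (LRmin α) * monomial x y β (des γ +ℕ 1) (asc γ +ℕ nonempty γ) 1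
          ≈⟨ *-cong (eulerWeight-monomial α)
                    (trans (*-congˡ (frameWeightˣ-monomial γ)) (sym (monomial-e¹ x y β (des γ +ℕ 1) (asc γ +ℕ nonempty γ)))) ⟨
        eulerWeight α * (β * frameWeightˣ γ)
          ≈⟨ x∙yz≈y∙xz (eulerWeight α) β (frameWeightˣ γ) ⟩
        β * (eulerWeight α * frameWeightˣ γ) ∎
        where
        des≡ : des σ +ℕ nonempty σ ≡ (des α +ℕ nonempty α) +ℕ (des γ +ℕ 1)
        des≡ rewrite nonempty-++-∷ α m γ | des-at-minimum α m γ below-α below-γ =
          ℕ.+-assoc (des α +ℕ nonempty α) (des γ) 1

      frameWeightˣ-at-minimum : frameWeightˣ σ ≈ 1# * (frameWeightʸ α * frameWeightˣ γ)
      frameWeightˣ-at-minimum = begin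
        frameWeightˣ σ
          ≈⟨ frameWeightˣ-monomial σ ⟩
        monomial x y β (des σ +ℕ 1) (asc σ +ℕ nonempty σ) 0
          ≈⟨ monomial-cong x y β {k = 0} {k′ = 0} des≡ asc≡ ≡.refl ⟩
        monomial x y β ((des α +ℕ nonempty α) +ℕ (des γ +ℕ 1)) ((asc α +ℕ 1) +ℕ (asc γ +ℕ nonempty γ)) (0 +ℕ 0)
          ≈⟨ monomial-+ x y β (des α +ℕ nonempty α) (asc α +ℕ 1) 0 (des γ +ℕ 1) (asc γ +ℕ nonempty γ) 0 ⟩
        monomial x y β (des α +ℕ nonempty α) (asc α +ℕ 1) 0 * monomial x y β (des γ +ℕ 1) (asc γ +ℕ nonempty γ) 0
          ≈⟨ *-cong (frameWeightʸ-monomial α) (frameWeightˣ-monomial γ) ⟨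
        frameWeightʸ α * frameWeightˣ γ
          ≈⟨ *-identityˡ _ ⟨
        1# * (frameWeightʸ α * frameWeightˣ γ) ∎
        where
        des≡ : des σ +ℕ 1 ≡ (des α +ℕ nonempty α) +ℕ (des γ +ℕ 1)
        des≡ rewrite des-at-minimum α m γ below-α below-γ = ℕ.+-assoc (des α +ℕ nonempty α) (des γ) 1
        asc≡ : asc σ +ℕ nonempty σ ≡ (asc α +ℕ 1) +ℕ (asc γ +ℕ nonempty γ)
        asc≡ rewrite nonempty-++-∷ α m γ | asc-at-minimum α m γ below-α below-γ =
          solve 2 (λ a g → (a :+ g) :+ con 1 := (a :+ con 1) :+ g) ≡.refl (asc α) (asc γ +ℕ nonempty γ)

      length-at-minimum : length σ ≡ (length α +ℕ 1) +ℕ length γ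
      length-at-minimum = ≡.trans (length-++ α)
        (solve 2 (λ a g → a :+ (con 1 :+ g) := (a :+ con 1) :+ g) ≡.refl (length α) (length γ))

      -- The bounds 2 * peaks ≤ length make the truncated subtractions in the exponents of s additive.
      peakWeight-at-minimum : peakWeight σ ≈ β * (peak₀Weight α * peakWeight γ)
      peakWeight-at-minimum = begin
        monomial (x * y) s β (L σ) (length σ ∸ 2 *ℕ L σ) (RLmin σ)
          ≈⟨ monomial-cong (x * y) s β L≡ s≡ (RLmin-at-minimum α m γ below-α below-γ) ⟩
        monomial (x * y) s β (peaks₀ α +ℕ L γ) (eα +ℕ (length γ ∸ 2 *ℕ L γ)) (1 +ℕ RLmin γ)
          ≈⟨ monomial-+ (x * y) s β (peaks₀ α) eα 1 (L γ) (length γ ∸ 2 *ℕ L γ) (RLmin γ) ⟩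
        monomial (x * y) s β (peaks₀ α) eα 1 * peakWeight γ
          ≈⟨ *-congʳ (trans (monomial-e¹ (x * y) s β (peaks₀ α) eα) (*-congˡ (*-identityʳ _))) ⟩
        β * peak₀Weight α * peakWeight γ
          ≈⟨ *-assoc _ _ _ ⟩
        β * (peak₀Weight α * peakWeight γ) ∎
        where
        eα : ℕ
        eα = (length α +ℕ 1) ∸ 2 *ℕ peaks₀ α
        L≡ : L σ ≡ peaks₀ α +ℕ L γ
        L≡ = L-at-minimum α m γ positive below-α below-γ
        s≡ : length σ ∸ 2 *ℕ L σ ≡ eα +ℕ (length γ ∸ 2 *ℕ L γ)
        s≡ = ≡.trans (≡.cong₂ _∸_ length-at-minimum
                       (≡.trans (≡.cong (2 *ℕ_) L≡) (ℕ.*-distribˡ-+ 2 (peaks₀ α) (L γ))))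
               ([m+n]∸[o+p]≡[m∸o]+[n∸p] _ _ _ _ (peaks₀-bound α) (L-bound γ))

      peak₀Weight-at-minimum : 1 ≤ length α +ℕ length γ → peak₀Weight σ ≈ 1# * (peak₀Weight α * peak₀Weight γ)
      peak₀Weight-at-minimum 1≤|α|+|γ| = begin
        peak₀Weight σ
          ≈⟨ *-identityʳ _ ⟨
        monomial (x * y) s β (peaks₀ σ) ((length σ +ℕ 1) ∸ 2 *ℕ peaks₀ σ) 0
          ≈⟨ monomial-cong (x * y) s β {k = 0} {k′ = 0} peaks₀≡ s≡ ≡.refl ⟩
        monomial (x * y) s β (peaks₀ α +ℕ peaks₀ γ) (eα +ℕ eγ) (0 +ℕ 0)
          ≈⟨ monomial-+ (x * y) s β (peaks₀ α) eα 0 (peaks₀ γ) eγ 0 ⟩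
        monomial (x * y) s β (peaks₀ α) eα 0 * monomial (x * y) s β (peaks₀ γ) eγ 0
          ≈⟨ *-cong (*-identityʳ _) (*-identityʳ _) ⟩
        peak₀Weight α * peak₀Weight γ
          ≈⟨ *-identityˡ _ ⟨
        1# * (peak₀Weight α * peak₀Weight γ) ∎
        where
        eα eγ : ℕ
        eα = (length α +ℕ 1) ∸ 2 *ℕ peaks₀ α
        eγ = (length γ +ℕ 1) ∸ 2 *ℕ peaks₀ γ
        peaks₀≡ : peaks₀ σ ≡ peaks₀ α +ℕ peaks₀ γ
        peaks₀≡ = peaks₀-at-minimum α m γ positive below-α below-γ 1≤|α|+|γ|
        s≡ : (length σ +ℕ 1) ∸ 2 *ℕ peaks₀ σ ≡ eα +ℕ eγ
        s≡ = ≡.trans (≡.cong₂ _∸_ length≡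
                       (≡.trans (≡.cong (2 *ℕ_) peaks₀≡) (ℕ.*-distribˡ-+ 2 (peaks₀ α) (peaks₀ γ))))
               ([m+n]∸[o+p]≡[m∸o]+[n∸p] _ _ _ _ (peaks₀-bound α) (peaks₀-bound γ))
          where
          length≡ : length σ +ℕ 1 ≡ (length α +ℕ 1) +ℕ (length γ +ℕ 1)
          length≡ = ≡.trans (≡.cong (_+ℕ 1) length-at-minimum) (ℕ.+-assoc (length α +ℕ 1) (length γ) 1)

    𝒫 𝒱 𝒜 𝒢ˣ 𝒢ʸ : List ℕ → Carrier
    𝒫 l  = ΣL (arrangements l) peakWeight
    𝒱 l  = ΣL (arrangements l) peak₀Weight
    𝒜 l  = ΣL (arrangements l) eulerWeight
    𝒢ˣ l = ΣL (arrangements l) frameWeightˣ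
    𝒢ʸ l = ΣL (arrangements l) frameWeightʸ

    module _ {m t} (inc : IncreasingPositive (m ∷ t)) where

      𝒫-∷ : 𝒫 (m ∷ t) ≈ β * ΣL (splits t) (λ p → 𝒱 (proj₁ p) * 𝒫 (proj₂ p))
      𝒫-∷ = ΣL-arrangements-at-minimum m t _ _ _ β inc (λ α γ split _ → peakWeight-at-minimum split)

      𝒜-∷ : 𝒜 (m ∷ t) ≈ β * ΣL (splits t) (λ p → 𝒜 (proj₁ p) * 𝒢ˣ (proj₂ p))
      𝒜-∷ = ΣL-arrangements-at-minimum m t _ _ _ β inc (λ α γ split _ → eulerWeight-at-minimum split)

      𝒢ˣ-∷ : 𝒢ˣ (m ∷ t) ≈ 1# * ΣL (splits t) (λ p → 𝒢ʸ (proj₁ p) * 𝒢ˣ (proj₂ p))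
      𝒢ˣ-∷ = ΣL-arrangements-at-minimum m t _ _ _ 1# inc (λ α γ split _ → frameWeightˣ-at-minimum split)

      𝒱-∷ : 1 ≤ length t → 𝒱 (m ∷ t) ≈ 1# * ΣL (splits t) (λ p → 𝒱 (proj₁ p) * 𝒱 (proj₂ p))
      𝒱-∷ 1≤|t| = ΣL-arrangements-at-minimum m t _ _ _ 1# inc
        (λ α γ split lengths → peak₀Weight-at-minimum split (ℕ.≤-trans 1≤|t| (ℕ.≤-reflexive (≡.sym lengths))))

    ΣL-arrangements-[] : ∀ (f : List ℕ → Carrier) → ΣL (arrangements []) f ≈ f []
    ΣL-arrangements-[] f = +-identityʳ _

    ΣL-arrangements-[-] : ∀ m (f : List ℕ → Carrier) → ΣL (arrangements (m ∷ [])) f ≈ f (m ∷ [])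
    ΣL-arrangements-[-] m f =
      trans (ΣL-arrangements-∷ m [] f) (trans (+-identityʳ _) (trans (+-identityʳ _) (+-identityʳ _)))

    𝒱-[] : 𝒱 [] ≈ s
    𝒱-[] = trans (ΣL-arrangements-[] peak₀Weight) (trans (*-identityˡ _) (*-identityʳ _))

    𝒢ˣ-[] : 𝒢ˣ [] ≈ x
    𝒢ˣ-[] = ΣL-arrangements-[] frameWeightˣ

    𝒢ʸ-[] : 𝒢ʸ [] ≈ y
    𝒢ʸ-[] = ΣL-arrangements-[] frameWeightʸ

    𝒱-[-] : ∀ {m} → 0 < m → 𝒱 (m ∷ []) ≈ x * y
    𝒱-[-] {m} 0<m = trans (ΣL-arrangements-[-] m peak₀Weight)
      (trans (*-cong (^-congʳ (x * y) (peaks₀-singleton 0<m)) (^-congʳ s s-exponent)) (trans (*-identityʳ _) (*-identityʳ _)))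
      where
      s-exponent : 2 ∸ 2 *ℕ peaks₀ (m ∷ []) ≡ 0
      s-exponent rewrite peaks₀-singleton 0<m = ≡.refl

    𝒢ˣ-[-] : ∀ m → 𝒢ˣ (m ∷ []) ≈ x * y
    𝒢ˣ-[-] m = trans (ΣL-arrangements-[-] m frameWeightˣ) (*-cong (*-identityʳ x) (*-identityʳ y))

    𝒢ʸ≈𝒢ˣ : ∀ m t → 𝒢ʸ (m ∷ t) ≈ 𝒢ˣ (m ∷ t)
    𝒢ʸ≈𝒢ˣ m t = ΣL-cong (arrangements (m ∷ t)) λ {σ} σ∈ →
      same-on-nonempty σ (↭-length (arrangements-↭ {l = m ∷ t} σ∈))
      where
      same-on-nonempty : ∀ σ → length σ ≡ suc (length t) → frameWeightʸ σ ≈ frameWeightˣ σ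
      same-on-nonempty (_ ∷ _) _ = refl

    double-injective : ∀ {a b} → a + a ≈ b + b → a ≈ b
    double-injective {a} {b} a+a≈b+b = begin
      a                ≈⟨ halve a ⟨
      h * (a + a)      ≈⟨ *-congˡ a+a≈b+b ⟩
      h * (b + b)      ≈⟨ halve b ⟩
      b                ∎
      where
      halve : ∀ a → h * (a + a) ≈ a
      halve a = trans (distribˡ h a a) (trans (sym (distribʳ a h h)) (trans (*-congʳ h+h≈1) (*-identityˡ a)))

    s+s≈x+y : s + s ≈ x + y
    s+s≈x+y = trans (sym (distribˡ (x + y) h h)) (trans (*-congˡ h+h≈1) (*-identityʳ _))

    -- 𝒱 [] = s = (𝒢ʸ [] + 𝒢ˣ []) / 2 is what compensates for 𝒢ʸ [] ≠ 𝒢ˣ [].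
    frames-beside-[] : ∀ γ → 𝒱 γ ≈ 𝒢ˣ γ → 𝒢ʸ γ ≈ 𝒢ˣ γ →
      𝒢ʸ [] * 𝒢ˣ γ + 𝒢ʸ γ * 𝒢ˣ [] ≈ 𝒱 [] * 𝒱 γ + 𝒱 [] * 𝒱 γ
    frames-beside-[] γ 𝒱≈𝒢ˣ 𝒢ʸ≈𝒢ˣ = begin
      𝒢ʸ [] * 𝒢ˣ γ + 𝒢ʸ γ * 𝒢ˣ [] ≈⟨ +-cong (*-congʳ 𝒢ʸ-[]) (*-congˡ 𝒢ˣ-[]) ⟩
      y * 𝒢ˣ γ + 𝒢ʸ γ * x       ≈⟨ +-congˡ (trans (*-comm _ _) (*-congˡ 𝒢ʸ≈𝒢ˣ)) ⟩
      y * 𝒢ˣ γ + x * 𝒢ˣ γ       ≈⟨ trans (+-comm _ _) (sym (distribʳ _ x y)) ⟩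
      (x + y) * 𝒢ˣ γ            ≈⟨ *-cong (sym s+s≈x+y) (sym 𝒱≈𝒢ˣ) ⟩
      (s + s) * 𝒱 γ             ≈⟨ distribʳ _ s s ⟩
      s * 𝒱 γ + s * 𝒱 γ         ≈⟨ +-cong (*-congʳ 𝒱-[]) (*-congʳ 𝒱-[]) ⟨
      𝒱 [] * 𝒱 γ + 𝒱 [] * 𝒱 γ   ∎

    𝒱≈𝒢ˣ : ∀ n m t → length t ≤ n → IncreasingPositive (m ∷ t) → 𝒱 (m ∷ t) ≈ 𝒢ˣ (m ∷ t)
    𝒱≈𝒢ˣ n       m []        _         inc = trans (𝒱-[-] (increasingPositive-head inc)) (sym (𝒢ˣ-[-] m))
    𝒱≈𝒢ˣ (suc n) m T@(_ ∷ _) (s≤s T≤n) inc = begin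
      𝒱 (m ∷ T)
        ≈⟨ 𝒱-∷ inc (s≤s z≤n) ⟩
      1# * ΣL (splits T) (λ p → 𝒱 (proj₁ p) * 𝒱 (proj₂ p))
        ≈⟨ *-congˡ (double-injective (sym (ΣL-splits-symmetrise T _ _ pair))) ⟩
      1# * ΣL (splits T) (λ p → 𝒢ʸ (proj₁ p) * 𝒢ˣ (proj₂ p))
        ≈⟨ 𝒢ˣ-∷ inc ⟨
      𝒢ˣ (m ∷ T) ∎
      where
      tail : IncreasingPositive T
      tail = increasingPositive-tail inc
      IH₁ : ∀ {a α γ} → (a ∷ α , γ) ∈ splits T → 𝒱 (a ∷ α) ≈ 𝒢ˣ (a ∷ α)
      IH₁ {a} {α} p∈ =
        𝒱≈𝒢ˣ n a α (ℕ.≤-trans (ℕ.≤-pred (splits-length₁ {t = T} p∈)) T≤n) (increasingPositive-splits₁ tail p∈)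
      IH₂ : ∀ {α c γ} → (α , c ∷ γ) ∈ splits T → 𝒱 (c ∷ γ) ≈ 𝒢ˣ (c ∷ γ)
      IH₂ {c = c} {γ} p∈ =
        𝒱≈𝒢ˣ n c γ (ℕ.≤-trans (ℕ.≤-pred (splits-length₂ {t = T} p∈)) T≤n) (increasingPositive-splits₂ tail p∈)
      pair : ∀ {p} → p ∈ splits T →
        𝒢ʸ (proj₁ p) * 𝒢ˣ (proj₂ p) + 𝒢ʸ (proj₂ p) * 𝒢ˣ (proj₁ p) ≈
        𝒱 (proj₁ p) * 𝒱 (proj₂ p) + 𝒱 (proj₁ p) * 𝒱 (proj₂ p)
      pair {[] , []} p∈ with () ← splits-length {t = T} p∈
      pair {[] , c ∷ γ} p∈ = frames-beside-[] (c ∷ γ) (IH₂ p∈) (𝒢ʸ≈𝒢ˣ c γ)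
      pair {a ∷ α , []} p∈ = begin
        𝒢ʸ (a ∷ α) * 𝒢ˣ [] + 𝒢ʸ [] * 𝒢ˣ (a ∷ α) ≈⟨ +-comm _ _ ⟩
        𝒢ʸ [] * 𝒢ˣ (a ∷ α) + 𝒢ʸ (a ∷ α) * 𝒢ˣ [] ≈⟨ frames-beside-[] (a ∷ α) (IH₁ p∈) (𝒢ʸ≈𝒢ˣ a α) ⟩
        𝒱 [] * 𝒱 (a ∷ α) + 𝒱 [] * 𝒱 (a ∷ α)     ≈⟨ +-cong (*-comm _ _) (*-comm _ _) ⟩
        𝒱 (a ∷ α) * 𝒱 [] + 𝒱 (a ∷ α) * 𝒱 []     ∎
      pair {a ∷ α , c ∷ γ} p∈ =
        +-cong (*-cong (trans (𝒢ʸ≈𝒢ˣ a α) (sym (IH₁ p∈))) (sym (IH₂ p∈)))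
               (trans (*-comm _ _) (*-cong (sym (IH₁ p∈)) (trans (𝒢ʸ≈𝒢ˣ c γ) (sym (IH₂ p∈)))))

    x+d≈s : x + d ≈ s
    x+d≈s = begin
      x + (y - x) * h                       ≈⟨ +-congʳ (trans (sym (*-identityʳ x)) (*-congˡ (sym h+h≈1))) ⟩
      x * (h + h) + (y - x) * h             ≈⟨ +-cong (distribˡ x h h) (distribʳ h y (- x)) ⟩
      (x * h + x * h) + (y * h + - x * h)   ≈⟨ +-interchange _ _ _ _ ⟩
      (x * h + y * h) + (x * h + - x * h)
        ≈⟨ +-congˡ (trans (sym (distribʳ h x (- x))) (trans (*-congʳ (-‿inverseʳ x)) (zeroˡ h))) ⟩
      (x * h + y * h) + 0#                  ≈⟨ +-identityʳ _ ⟩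
      x * h + y * h                         ≈⟨ distribʳ h x y ⟨
      (x + y) * h                           ∎

    𝒱≈𝒢ˣ+𝟙[]d : ∀ l → IncreasingPositive l → 𝒱 l ≈ 𝒢ˣ l + 𝟙[] l * d
    𝒱≈𝒢ˣ+𝟙[]d []      _   =
      trans 𝒱-[] (trans (sym x+d≈s) (+-cong (sym 𝒢ˣ-[]) (sym (*-identityˡ d))))
    𝒱≈𝒢ˣ+𝟙[]d (m ∷ t) inc =
      trans (𝒱≈𝒢ˣ (length t) m t ℕ.≤-refl inc) (sym (trans (+-congˡ (zeroˡ d)) (+-identityʳ _)))

    𝒯 : List ℕ → Carrier
    𝒯 l = ΣL (splits l) (λ p → u ^ length (proj₂ p) * 𝒜 (proj₁ p))

    module _ {m t} (inc : IncreasingPositive (m ∷ t)) where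

      private
        tail : IncreasingPositive t
        tail = increasingPositive-tail inc
        framed : List ℕ → List ℕ → List ℕ → Carrier
        framed α γ δ = u ^ length δ * (𝒜 α * 𝒢ˣ γ)

      𝒯-∷-first : ΣL (splits t) (λ p → u ^ length (proj₂ p) * 𝒜 (m ∷ proj₁ p)) ≈
                  β * ΣL (splits t) (λ p → 𝒢ˣ (proj₁ p) * 𝒯 (proj₂ p))
      𝒯-∷-first = begin
        ΣL (splits t) (λ p → u ^ length (proj₂ p) * 𝒜 (m ∷ proj₁ p))
          ≈⟨ ΣL-cong (splits t) (λ p∈ → *-congˡ (𝒜-∷ (head∷split₁ p∈))) ⟩
        ΣL (splits t) (λ p → u ^ length (proj₂ p) * (β * ΣL (splits (proj₁ p)) (λ q → 𝒜 (proj₁ q) * 𝒢ˣ (proj₂ q))))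
          ≈⟨ ΣL-cong (splits t) (λ {p} _ → trans (x∙yz≈y∙xz _ _ _) (*-congˡ (sym (ΣL-*ˡ (splits (proj₁ p)) _ _)))) ⟩
        ΣL (splits t) (λ p → β * ΣL (splits (proj₁ p)) (λ q → framed (proj₁ q) (proj₂ q) (proj₂ p)))
          ≈⟨ ΣL-*ˡ (splits t) β _ ⟩
        β * ΣL (splits t) (λ p → ΣL (splits (proj₁ p)) (λ q → framed (proj₁ q) (proj₂ q) (proj₂ p)))
          ≈⟨ *-congˡ (ΣL-splits-assoc t framed) ⟩
        β * ΣL (splits t) (λ p → ΣL (splits (proj₂ p)) (λ q → framed (proj₁ q) (proj₁ p) (proj₂ q)))
          ≈⟨ *-congˡ (ΣL-cong (splits t) (λ {p} _ →
               trans (ΣL-cong (splits (proj₂ p)) (λ _ → x∙yz≈z∙xy _ _ _)) (ΣL-*ˡ (splits (proj₂ p)) _ _))) ⟩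
        β * ΣL (splits t) (λ p → 𝒢ˣ (proj₁ p) * 𝒯 (proj₂ p)) ∎
        where
        head∷split₁ : ∀ {p} → p ∈ splits t → IncreasingPositive (m ∷ proj₁ p)
        head∷split₁ {p} p∈ =
          (increasingPositive-head inc ∷ proj₁ (increasingPositive-splits₁ tail p∈)) ,
          (proj₁ (splits-All {t = t} p∈ (increasingPositive-minimum inc)) ∷ proj₂ (increasingPositive-splits₁ tail p∈))

      𝒯-∷-last : ΣL (splits t) (λ p → u ^ suc (length (proj₂ p)) * 𝒜 (proj₁ p)) ≈ β * (d * 𝒯 t)
      𝒯-∷-last = begin
        ΣL (splits t) (λ p → u * u ^ length (proj₂ p) * 𝒜 (proj₁ p)) ≈⟨ ΣL-cong (splits t) (λ _ → *-assoc _ _ _) ⟩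
        ΣL (splits t) (λ p → u * (u ^ length (proj₂ p) * 𝒜 (proj₁ p))) ≈⟨ ΣL-*ˡ (splits t) u _ ⟩
        u * 𝒯 t                                                          ≈⟨ *-congʳ (*-assoc β (y - x) h) ⟩
        β * d * 𝒯 t                                                      ≈⟨ *-assoc β d (𝒯 t) ⟩
        β * (d * 𝒯 t)                                                    ∎

      ΣL-splits-𝒱𝒯 : ΣL (splits t) (λ p → 𝒱 (proj₁ p) * 𝒯 (proj₂ p)) ≈
                     ΣL (splits t) (λ p → 𝒢ˣ (proj₁ p) * 𝒯 (proj₂ p)) + d * 𝒯 t
      ΣL-splits-𝒱𝒯 = begin
        ΣL (splits t) (λ p → 𝒱 (proj₁ p) * 𝒯 (proj₂ p))
          ≈⟨ ΣL-cong (splits t) (λ {p} p∈ →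
               trans (*-congʳ (𝒱≈𝒢ˣ+𝟙[]d (proj₁ p) (increasingPositive-splits₁ tail p∈))) (distribʳ _ _ _)) ⟩
        ΣL (splits t) (λ p → 𝒢ˣ (proj₁ p) * 𝒯 (proj₂ p) + 𝟙[] (proj₁ p) * d * 𝒯 (proj₂ p))
          ≈⟨ ΣL-+ (splits t) _ _ ⟩
        ΣL (splits t) (λ p → 𝒢ˣ (proj₁ p) * 𝒯 (proj₂ p)) + ΣL (splits t) (λ p → 𝟙[] (proj₁ p) * d * 𝒯 (proj₂ p))
          ≈⟨ +-congˡ (trans (ΣL-cong (splits t) (λ _ → *-assoc _ _ _)) (ΣL-splits-𝟙[] t (λ δ → d * 𝒯 δ))) ⟩
        ΣL (splits t) (λ p → 𝒢ˣ (proj₁ p) * 𝒯 (proj₂ p)) + d * 𝒯 t ∎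

      𝒯-∷ : 𝒯 (m ∷ t) ≈ β * ΣL (splits t) (λ p → 𝒱 (proj₁ p) * 𝒯 (proj₂ p))
      𝒯-∷ = begin
        𝒯 (m ∷ t)
          ≈⟨ ΣL-splits-∷ m t _ ⟩
        ΣL (splits t) (λ p → u ^ length (proj₂ p) * 𝒜 (m ∷ proj₁ p)) +
        ΣL (splits t) (λ p → u ^ suc (length (proj₂ p)) * 𝒜 (proj₁ p))
          ≈⟨ +-cong 𝒯-∷-first 𝒯-∷-last ⟩
        β * ΣL (splits t) (λ p → 𝒢ˣ (proj₁ p) * 𝒯 (proj₂ p)) + β * (d * 𝒯 t)
          ≈⟨ distribˡ β _ _ ⟨
        β * (ΣL (splits t) (λ p → 𝒢ˣ (proj₁ p) * 𝒯 (proj₂ p)) + d * 𝒯 t)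
          ≈⟨ *-congˡ ΣL-splits-𝒱𝒯 ⟨
        β * ΣL (splits t) (λ p → 𝒱 (proj₁ p) * 𝒯 (proj₂ p)) ∎

    𝒫≈𝒯 : ∀ n l → length l ≤ n → IncreasingPositive l → 𝒫 l ≈ 𝒯 l
    𝒫≈𝒯 n       []      _         _   = trans (+-identityʳ _) (trans (*-identityʳ _) (trans (*-identityʳ _)
                                          (sym (trans (+-identityʳ _) (trans (*-identityˡ _) (+-identityʳ _))))))
    𝒫≈𝒯 (suc n) (m ∷ t) (s≤s t≤n) inc = begin
      𝒫 (m ∷ t)                                            ≈⟨ 𝒫-∷ inc ⟩
      β * ΣL (splits t) (λ p → 𝒱 (proj₁ p) * 𝒫 (proj₂ p))  ≈⟨ *-congˡ (ΣL-cong (splits t) (λ p∈ → *-congˡ (IH p∈))) ⟩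
      β * ΣL (splits t) (λ p → 𝒱 (proj₁ p) * 𝒯 (proj₂ p))  ≈⟨ 𝒯-∷ inc ⟨
      𝒯 (m ∷ t)                                            ∎
      where
      IH : ∀ {p} → p ∈ splits t → 𝒫 (proj₂ p) ≈ 𝒯 (proj₂ p)
      IH {p} p∈ = 𝒫≈𝒯 n (proj₂ p) (ℕ.≤-trans (splits-length₂ {t = t} p∈) t≤n)
                       (increasingPositive-splits₂ (increasingPositive-tail inc) p∈)

    𝒱-length-invariant : ∀ n l l′ → length l ≤ n → length l ≡ length l′ →
      IncreasingPositive l → IncreasingPositive l′ → 𝒱 l ≈ 𝒱 l′
    𝒱-length-invariant n       []          []            _         _ _   _    = refl
    𝒱-length-invariant n       (m ∷ [])    (m′ ∷ [])     _         _ inc inc′ =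
      trans (𝒱-[-] (increasingPositive-head inc)) (sym (𝒱-[-] (increasingPositive-head inc′)))
    𝒱-length-invariant (suc n) (m ∷ t@(_ ∷ _)) (m′ ∷ t′@(_ ∷ _)) (s≤s t≤n) l≡l′ inc inc′ = begin
      𝒱 (m ∷ t)
        ≈⟨ 𝒱-∷ inc (s≤s z≤n) ⟩
      1# * ΣL (splits t) (λ p → 𝒱 (proj₁ p) * 𝒱 (proj₂ p))
        ≈⟨ *-congˡ (ΣL-splits-parallel t t′ _ _ (ℕ.suc-injective l≡l′) IH) ⟩
      1# * ΣL (splits t′) (λ p → 𝒱 (proj₁ p) * 𝒱 (proj₂ p))
        ≈⟨ 𝒱-∷ inc′ (s≤s z≤n) ⟨
      𝒱 (m′ ∷ t′) ∎
      where
      tail : IncreasingPositive t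
      tail = increasingPositive-tail inc
      tail′ : IncreasingPositive t′
      tail′ = increasingPositive-tail inc′
      IH : ∀ {p p′} → p ∈ splits t → p′ ∈ splits t′ →
        length (proj₁ p) ≡ length (proj₁ p′) → length (proj₂ p) ≡ length (proj₂ p′) →
        𝒱 (proj₁ p) * 𝒱 (proj₂ p) ≈ 𝒱 (proj₁ p′) * 𝒱 (proj₂ p′)
      IH {p} {p′} p∈ p′∈ e₁ e₂ = *-cong
        (𝒱-length-invariant n (proj₁ p) (proj₁ p′) (ℕ.≤-trans (splits-length₁ {t = t} p∈) t≤n) e₁
          (increasingPositive-splits₁ tail p∈) (increasingPositive-splits₁ tail′ p′∈))
        (𝒱-length-invariant n (proj₂ p) (proj₂ p′) (ℕ.≤-trans (splits-length₂ {t = t} p∈) t≤n) e₂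
          (increasingPositive-splits₂ tail p∈) (increasingPositive-splits₂ tail′ p′∈))

    𝒢ˣ-length-invariant : ∀ l l′ → length l ≡ length l′ →
      IncreasingPositive l → IncreasingPositive l′ → 𝒢ˣ l ≈ 𝒢ˣ l′
    𝒢ˣ-length-invariant l l′ l≡l′ inc inc′ = +-cancelʳ (𝟙[] l * d) _ _ (begin
      𝒢ˣ l + 𝟙[] l * d     ≈⟨ 𝒱≈𝒢ˣ+𝟙[]d l inc ⟨
      𝒱 l                  ≈⟨ 𝒱-length-invariant (length l) l l′ ℕ.≤-refl l≡l′ inc inc′ ⟩
      𝒱 l′                 ≈⟨ 𝒱≈𝒢ˣ+𝟙[]d l′ inc′ ⟩
      𝒢ˣ l′ + 𝟙[] l′ * d   ≈⟨ +-congˡ (*-congʳ (reflexive (𝟙[]-length l l′ l≡l′))) ⟨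
      𝒢ˣ l′ + 𝟙[] l * d    ∎)
      where
      𝟙[]-length : ∀ l l′ → length l ≡ length l′ → 𝟙[] l ≡ 𝟙[] l′
      𝟙[]-length []      []      _ = ≡.refl
      𝟙[]-length (_ ∷ _) (_ ∷ _) _ = ≡.refl

    𝒜-length-invariant : ∀ n l l′ → length l ≤ n → length l ≡ length l′ →
      IncreasingPositive l → IncreasingPositive l′ → 𝒜 l ≈ 𝒜 l′
    𝒜-length-invariant n       []      []        _         _     _   _    = refl
    𝒜-length-invariant (suc n) (m ∷ t) (m′ ∷ t′) (s≤s t≤n) l≡l′ inc inc′ = begin
      𝒜 (m ∷ t)
        ≈⟨ 𝒜-∷ inc ⟩
      β * ΣL (splits t) (λ p → 𝒜 (proj₁ p) * 𝒢ˣ (proj₂ p))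
        ≈⟨ *-congˡ (ΣL-splits-parallel t t′ _ _ (ℕ.suc-injective l≡l′) IH) ⟩
      β * ΣL (splits t′) (λ p → 𝒜 (proj₁ p) * 𝒢ˣ (proj₂ p))
        ≈⟨ 𝒜-∷ inc′ ⟨
      𝒜 (m′ ∷ t′) ∎
      where
      tail : IncreasingPositive t
      tail = increasingPositive-tail inc
      tail′ : IncreasingPositive t′
      tail′ = increasingPositive-tail inc′
      IH : ∀ {p p′} → p ∈ splits t → p′ ∈ splits t′ →
        length (proj₁ p) ≡ length (proj₁ p′) → length (proj₂ p) ≡ length (proj₂ p′) →
        𝒜 (proj₁ p) * 𝒢ˣ (proj₂ p) ≈ 𝒜 (proj₁ p′) * 𝒢ˣ (proj₂ p′)
      IH {p} {p′} p∈ p′∈ e₁ e₂ = *-cong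
        (𝒜-length-invariant n (proj₁ p) (proj₁ p′) (ℕ.≤-trans (splits-length₁ {t = t} p∈) t≤n) e₁
          (increasingPositive-splits₁ tail p∈) (increasingPositive-splits₁ tail′ p′∈))
        (𝒢ˣ-length-invariant (proj₂ p) (proj₂ p′) e₂ (increasingPositive-splits₂ tail p∈) (increasingPositive-splits₂ tail′ p′∈))

    ΣL-𝔖-peakWeight : ∀ n → ΣL (𝔖 n) (λ σ → (x * y) ^ L σ * s ^ (n ∸ 2 *ℕ L σ) * β ^ RLmin σ) ≈ 𝒫 (range n)
    ΣL-𝔖-peakWeight n = trans (ΣL-↭ _ (𝔖↭arrangements n)) (ΣL-cong (arrangements (range n)) λ {σ} σ∈ →
      reflexive (≡.cong (λ k → (x * y) ^ L σ * s ^ (k ∸ 2 *ℕ L σ) * β ^ RLmin σ) (≡.sym (length-arrangement σ∈))))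
      where
      length-arrangement : ∀ {σ} → σ ∈ arrangements (range n) → length σ ≡ n
      length-arrangement σ∈ = ≡.trans (↭-length (arrangements-↭ {l = range n} σ∈)) (length-range n)

    𝒜-range≈ΣL-𝔖 : ∀ k → 1 ≤ k → 𝒜 (range k) ≈ ΣL (𝔖 k) (λ σ → x ^ (des σ +ℕ 1) * y ^ asc σ * β ^ LRmin σ)
    𝒜-range≈ΣL-𝔖 k 1≤k = trans (ΣL-cong (arrangements (range k)) λ {σ} σ∈ →
        nonempty-weights σ (≡.trans (↭-length (arrangements-↭ {l = range k} σ∈)) (length-range k)))
      (sym (ΣL-↭ _ (𝔖↭arrangements k)))
      where
      nonempty-weights : ∀ σ → length σ ≡ k → eulerWeight σ ≈ x ^ (des σ +ℕ 1) * y ^ asc σ * β ^ LRmin σ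
      nonempty-weights []      length≡k with () ← ≡.subst (1 ≤_) (≡.sym length≡k) 1≤k
      nonempty-weights (_ ∷ _) _        = refl

    𝒯-range≈binomialSum : ∀ n → 𝒯 (range n) ≈ binomialSum n (λ k e → u ^ e * 𝒜 (range k))
    𝒯-range≈binomialSum n = begin
      𝒯 (range n)
        ≈⟨ ΣL-cong (splits (range n)) (λ {p} p∈ → *-congˡ (𝒜-length-invariant _ (proj₁ p) (range (length (proj₁ p)))
             ℕ.≤-refl (≡.sym (length-range _)) (increasingPositive-splits₁ (range-increasingPositive n) p∈)
             (range-increasingPositive _))) ⟩
      ΣL (splits (range n)) (λ p → u ^ length (proj₂ p) * 𝒜 (range (length (proj₁ p))))
        ≈⟨ ΣL-splits-lengths (range n) (λ k e → u ^ e * 𝒜 (range k)) ⟩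
      binomialSum (length (range n)) (λ k e → u ^ e * 𝒜 (range k))
        ≡⟨ ≡.cong (λ N → binomialSum N (λ k e → u ^ e * 𝒜 (range k))) (length-range n) ⟩
      binomialSum n (λ k e → u ^ e * 𝒜 (range k)) ∎

    binomialSum-𝒜 : ∀ n → binomialSum n (λ k e → u ^ e * 𝒜 (range k)) ≈
      Σ1 n (λ k → ((n C k) × (u ^ (n ∸ k))) * ΣL (𝔖 k) (λ σ → x ^ (des σ +ℕ 1) * y ^ asc σ * β ^ LRmin σ)) + u ^ n
    binomialSum-𝒜 n = trans (+-cong empty-term (Σ1-cong n λ k 1≤k _ →
        trans (Mult.×-congʳ (n C k) (*-congˡ (𝒜-range≈ΣL-𝔖 k 1≤k))) (sym (Mult.×-assoc-* (n C k) _ _))))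
      (+-comm _ _)
      where
      empty-term : 1 × (u ^ n * 𝒜 []) ≈ u ^ n
      empty-term = trans (Mult.×-homo-1 _) (trans (*-congˡ (ΣL-arrangements-[] eulerWeight)) (*-identityʳ _))

mainTheorem14 : {c ℓ : Level} (R : CommutativeRing c ℓ) →
  let open CommutativeRing R
      open RingSums R
  in (h : Carrier) → h + h ≈ 1# →
     (n : ℕ) → 1 ≤ n → (x y β : Carrier) →
     ΣL (𝔖 n) (λ σ → ((x * y) ^ L σ) * (((x + y) * h) ^ (n ∸ 2 *ℕ L σ)) * (β ^ RLmin σ))
     ≈ Σ1 n (λ k → ((n C k) × ((β * (y - x) * h) ^ (n ∸ k)))
                   * ΣL (𝔖 k) (λ σ → (x ^ (des σ +ℕ 1)) * (y ^ asc σ) * (β ^ LRmin σ)))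
       + ((β * (y - x) * h) ^ n)
mainTheorem14 R h h+h≈1 n _ x y β = begin  -- for n = 0 both sides are 1
  ΣL (𝔖 n) (λ σ → (x * y) ^ L σ * s ^ (n ∸ 2 *ℕ L σ) * β ^ RLmin σ)
    ≈⟨ ΣL-𝔖-peakWeight n ⟩
  𝒫 (range n)
    ≈⟨ 𝒫≈𝒯 n (range n) (≤-reflexive (length-range n)) (range-increasingPositive n) ⟩
  𝒯 (range n)
    ≈⟨ 𝒯-range≈binomialSum n ⟩
  binomialSum n (λ k e → u ^ e * 𝒜 (range k))
    ≈⟨ binomialSum-𝒜 n ⟩
  Σ1 n (λ k → ((n C k) × (u ^ (n ∸ k))) * ΣL (𝔖 k) (λ σ → x ^ (des σ +ℕ 1) * y ^ asc σ * β ^ LRmin σ)) + u ^ n ∎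
  where
  open CommutativeRing R
  open RingSums R
  open Permutations using (range; length-range; range-increasingPositive)
  open Sums R using (binomialSum)
  open GeneratingFunctions.Weights R h h+h≈1 x y β
  open import Data.Nat.Properties using (≤-reflexive)
  open import Relation.Binary.Reasoning.Setoid setoid
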